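{- Let $p$ be a prime, let $a$ be a positive integer and let $A,B\in\mathbb Z$; write $u_n=u_n(A,B)$, $v_n=v_n(A,B)$ and $\Delta=A^2-4B$. Then $v_{p^a}\equiv v_{p^{a-1}}\pmod{p^a}$. If $p\neq2$, then $u_{p^a}\equiv(\frac{\Delta}p)u_{p^{a-1}}\pmod{p^a}$. When $p\nmid 2B\Delta$, we have $$u_{p^a-(\frac{\Delta}{p^a})}\equiv B^{((\frac{\Delta}{p^{a-1}})-(\frac{\Delta}{p^a}))/2}\left(\tfrac{\Delta}p\right)u_{p^{a-1}-(\frac{\Delta}{p^{a-1}})}\pmod{p^a},$$ $$u_{p^a-(\frac{\Delta}{p^a})}\equiv B^{((\frac{\Delta}{p})-(\frac{\Delta}{p^a}))/2}\left(\tfrac{\Delta}{p^{a-1}}\right)u_{p-(\frac{\Delta}{p})}\pmod{p^2},\qquad u_{p^a-(\frac{\Delta}{p^a})}\equiv0\pmod p,$$ and $$v_{p^a-(\frac{\Delta}{p^a})}\equiv B^{((\frac{\Delta}{p^{a-1}})-(\frac{\Delta}{p^a}))/2}v_{p^{a-1}-(\frac{\Delta}{p^{a-1}})}\pmod{p^a},$$ $$v_{p^a-(\frac{\Delta}{p^a})}\equiv B^{((\frac{\Delta}{p})-(\frac{\Delta}{p^a}))/2}v_{p-(\frac{\Delta}{p})}\pmod{p^2},\qquad v_{p^a-(\frac{\Delta}{p^a})}\equiv 2B^{(1-(\frac{\Delta}{p^a}))/2}\pmod p.$$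
   Context: For integers $A,B$ the Lucas sequences are defined by $u_0=0$, $u_1=1$, $u_{n+1}=Au_n-Bu_{n-1}$ and $v_0=2$, $v_1=A$, $v_{n+1}=Av_n-Bv_{n-1}$ ($n\ge1$). $(\frac{\cdot}{\cdot})$ denotes the Jacobi symbol, with $(\frac{\Delta}{p^0})=1$. Powers of $B$ with negative exponent are interpreted modulo powers of $p$ (where $p\nmid B$). -}

module Defs where

open import Data.Nat as ℕ using (ℕ; zero; suc)
open import Data.Nat.Divisibility as ℕD using ()
open import Data.Integer using (ℤ; +_; -[1+_]; _+_; _-_; _*_; -_; ∣_∣; _^_; 0ℤ; 1ℤ)
open import Data.Integer.Divisibility using (_∣_)
open import Data.List using (upTo)
open import Data.List.Relation.Unary.Any using (any?)
open import Relation.Nullary.Decidable using (does)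
open import Data.Product using (_×_; _,_)
open import Data.Bool using (if_then_else_)

lucasU : ℤ → ℤ → ℕ → ℤ
lucasU A B zero = + 0
lucasU A B (suc zero) = + 1
lucasU A B (suc (suc n)) = A * lucasU A B (suc n) - B * lucasU A B n

lucasV : ℤ → ℤ → ℕ → ℤ
lucasV A B zero = + 2
lucasV A B (suc zero) = A
lucasV A B (suc (suc n)) = A * lucasV A B (suc n) - B * lucasV A B n

infix 4 _≡_[mod_]

_≡_[mod_] : ℤ → ℤ → ℕ → Set
x ≡ y [mod m ] = (+ m) ∣ (x - y)

legendre : ℕ → ℤ → ℤ
legendre p Δ =
  if does (p ℕD.∣? ∣ Δ ∣) then 0ℤ
  else if does (any? (λ x → p ℕD.∣? ∣ Δ - (+ x) * (+ x) ∣) (upTo p)) then 1ℤ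
  else - 1ℤ

-- Jacobi symbol with prime-power denominator: (Δ/p^k) = (Δ/p)^k,
-- in particular (Δ/p^0) = 1.
jacobiPP : ℕ → ℕ → ℤ → ℤ
jacobiPP p k Δ = legendre p Δ ^ k

-- congBPow m B e x y means "x ≡ B^e * y (mod m)" for an integer exponent e, where a negative power
-- of B is read as an inverse of B modulo m (meaningful when gcd(B,m)=1):
-- for e = -n (n > 0) this means B^n * x ≡ y (mod m).
congBPow : (m : ℕ) (B e x y : ℤ) → Set
congBPow m B (+ n) x y = x ≡ ((B ^ n) * y) [mod m ]
congBPow m B -[1+ n ] x y = ((B ^ suc n) * x) ≡ y [mod m ]

-- Let R = ℤ[α] with α² = Aα − B, represented by pairs a + bα, with
-- conjugation σ(α) = A − α and trace tr(z) = z + σ(z).  Then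
-- α^(n+1) = −B u_n + u_(n+1) α  and  v_n = tr(α^n).
--  * v-part (every prime p): the composition law v_(km) = V_k(v_m, B^m),
--    the "Taylor" fact that V_p(x,y) mod p²d only depends on (x,y) mod pd,
--    and v_p ≡ A (mod p) give v_(p^(k+1)) ≡ v_(p^k) (mod p^(k+1)) by induction.
--  * u-part (odd p): Frobenius (x+y)^p ≡ x^p + y^p (mod p) in R together with
--    Euler's criterion Δ^((p−1)/2) ≡ (Δ/p) shows α^p ≡ α, σα or A/2 (mod p)
--    according as (Δ/p) = 1, −1, 0.  Raising a congruence mod p^j to the p-th
--    power yields one mod p^(j+1), so α^(p^(k+1)) ≡ γ^(p^k) (mod p^(k+1)).
--    Reading off coordinates gives u_(p^a) ≡ (Δ/p) u_(p^(a−1)); eliminating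
--    neighbouring indices with the recurrences gives the statements at the
--    index p^a − (Δ/p^a), and chaining these down to a = 1 gives the mod p²
--    and mod p statements.

module Submission where

import Data.Integer
import Data.Nat
import Data.Nat.Primality

module Congruence where

  open import Data.Nat as ℕ using (ℕ; zero; suc)
  import Data.Nat.Properties as ℕP
  import Data.Nat.Divisibility as ℕD
  open import Data.Nat.Primality using (Prime; euclidsLemma; prime⇒nonZero; prime⇒nonTrivial)
  open import Data.Integer as ℤ using (ℤ; +_; -[1+_]; _+_; _-_; _*_; -_; ∣_∣; _^_)
  open import Data.Integer.Properties
  open import Data.Integer.Tactic.RingSolver
  open import Data.Integer.Divisibility using (_∣_)
  open import Data.Sum using (_⊎_; inj₁; inj₂)
  open import Relation.Binary.PropositionalEquality
  open import Relation.Nullary using (¬_)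
  open import Data.Empty using (⊥-elim)

  infix 4 _≈[_]_
  infixr 4 _,_
  record _≈[_]_ (x : ℤ) (m : ℕ) (y : ℤ) : Set where
    constructor _,_
    field
      wit : ℤ
      eqn : x ≡ y + wit * + m

  module _ {m : ℕ} where
    crefl : ∀ {x} → x ≈[ m ] x
    crefl {x} = + 0 , norm x (+ m)
      where norm : ∀ x M → x ≡ x + + 0 * M
            norm = solve-∀

    ceq : ∀ {x y} → x ≡ y → x ≈[ m ] y
    ceq refl = crefl

    csym : ∀ {x y} → x ≈[ m ] y → y ≈[ m ] x
    csym {x} {y} (k , refl) = - k , norm y k (+ m)
      where norm : ∀ y k M → y ≡ y + k * M + - k * M
            norm = solve-∀

    ctrans : ∀ {x y z} → x ≈[ m ] y → y ≈[ m ] z → x ≈[ m ] z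
    ctrans {x} {y} {z} (k , refl) (l , refl) = l + k , norm z k l (+ m)
      where norm : ∀ z k l M → z + l * M + k * M ≡ z + (l + k) * M
            norm = solve-∀

    c+ : ∀ {x x' y y'} → x ≈[ m ] x' → y ≈[ m ] y' → x + y ≈[ m ] x' + y'
    c+ {x' = x'} {y' = y'} (k , refl) (l , refl) = k + l , norm x' y' k l (+ m)
      where norm : ∀ x y k l M → x + k * M + (y + l * M) ≡ x + y + (k + l) * M
            norm = solve-∀

    cneg : ∀ {x x'} → x ≈[ m ] x' → - x ≈[ m ] - x'
    cneg {x' = x'} (k , refl) = - k , norm x' k (+ m)
      where norm : ∀ x k M → - (x + k * M) ≡ - x + - k * M
            norm = solve-∀

    c- : ∀ {x x' y y'} → x ≈[ m ] x' → y ≈[ m ] y' → x - y ≈[ m ] x' - y'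
    c- p q = c+ p (cneg q)

    c* : ∀ {x x' y y'} → x ≈[ m ] x' → y ≈[ m ] y' → x * y ≈[ m ] x' * y'
    c* {x' = x'} {y' = y'} (k , refl) (l , refl) = x' * l + k * y' + k * l * + m , norm x' y' k l (+ m)
      where norm : ∀ x y k l M → (x + k * M) * (y + l * M) ≡ x * y + (x * l + k * y + k * l * M) * M
            norm = solve-∀

    c*l : ∀ c {y y'} → y ≈[ m ] y' → c * y ≈[ m ] c * y'
    c*l c q = c* (crefl {c}) q

    c^ : ∀ {x x'} n → x ≈[ m ] x' → x ^ n ≈[ m ] x' ^ n
    c^ zero p = crefl
    c^ (suc n) p = c* p (c^ n p)

    c0→ : ∀ {x y} → x - y ≈[ m ] + 0 → x ≈[ m ] y
    c0→ {x} {y} (k , e) = k , norm x y k (+ m) e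
      where norm : ∀ x y k M → x - y ≡ + 0 + k * M → x ≡ y + k * M
            norm x y k M e = trans (shift x y) (trans (cong (λ t → y + t) e) (cong (λ t → y + t) (+-identityˡ (k * M))))
              where shift : ∀ x y → x ≡ y + (x - y)
                    shift = solve-∀

    →c0 : ∀ {x y} → x ≈[ m ] y → x - y ≈[ m ] + 0
    →c0 {x} {y} (k , refl) = k , norm y k (+ m)
      where norm : ∀ y k M → y + k * M - y ≡ + 0 + k * M
            norm = solve-∀

  cweak : ∀ {x y} m n → x ≈[ m ℕ.* n ] y → x ≈[ m ] y
  cweak {x} {y} m n (k , refl) = k * + n , trans (cong (λ t → y + k * t) (pos-* m n)) (norm y k (+ m) (+ n))
    where norm : ∀ y k M N → y + k * (M * N) ≡ y + k * N * M
          norm = solve-∀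

  cmod : ∀ {x y m n} → m ≡ n → x ≈[ m ] y → x ≈[ n ] y
  cmod refl h = h

  mod1 : ∀ {x y} m → x ≈[ m ] y → x ≈[ m ℕ.^ 1 ] y
  mod1 m = cmod (sym (ℕP.*-identityʳ m))

  toDiv : ∀ {x y m} → x ≈[ m ] y → (+ m) ∣ (x - y)
  toDiv {x} {y} {m} (k , refl) = ℕD.divides ∣ k ∣ (trans (cong ∣_∣ (norm y k (+ m))) (abs-* k (+ m)))
    where norm : ∀ y k M → y + k * M - y ≡ k * M
          norm = solve-∀

  toDiv0 : ∀ {d m} → d ≈[ m ] + 0 → (+ m) ∣ d
  toDiv0 {d} {m} e = subst ((+ m) ∣_) (norm d) (toDiv e)
    where norm : ∀ z → z - + 0 ≡ z
          norm = solve-∀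

  fromDiv : ∀ {x m} → (+ m) ∣ x → x ≈[ m ] + 0
  fromDiv {+ n} {m} (ℕD.divides q e) = + q , trans (cong +_ e) (trans (pos-* q m) (sym (+-identityˡ _)))
  fromDiv { -[1+ n ]} {m} (ℕD.divides q e) = - (+ q) , trans (cong (λ t → - (+ t)) e)
    (trans (cong -_ (pos-* q m)) (trans (neg-distribˡ-* (+ q) (+ m)) (sym (+-identityˡ _))))

  module ModPrime (p : ℕ) (pp : Prime p) where
    instance
      p≢0 : ℕ.NonZero p
      p≢0 = prime⇒nonZero pp

    p>1 : 1 ℕ.< p
    p>1 = ℕ.nonTrivial⇒n>1 p {{prime⇒nonTrivial pp}}

    p≥1 : 1 ℕ.≤ p
    p≥1 = ℕP.<⇒≤ p>1

    euclid : ∀ x y → x * y ≈[ p ] + 0 → x ≈[ p ] + 0 ⊎ y ≈[ p ] + 0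
    euclid x y h with euclidsLemma ∣ x ∣ ∣ y ∣ pp (subst (p ℕD.∣_) (abs-* x y) (toDiv0 h))
    ... | inj₁ d = inj₁ (fromDiv {x} d)
    ... | inj₂ d = inj₂ (fromDiv {y} d)

    mulp : ∀ n y → y ≈[ n ] + 0 → y * + p ≈[ p ℕ.* n ] + 0
    mulp n y (j , refl) = j , trans (norm j (+ p) (+ n)) (cong (λ t → + 0 + j * t) (sym (pos-* p n)))
      where norm : ∀ j P N → (+ 0 + j * N) * P ≡ + 0 + j * (P * N)
            norm = solve-∀

    cancelp : ∀ n y → y * + p ≈[ p ℕ.* n ] + 0 → y ≈[ n ] + 0
    cancelp n y (j , e) = j , *-cancelʳ-≡ _ _ (+ p) (trans e (trans (cong (λ t → + 0 + j * t) (pos-* p n)) (norm j (+ p) (+ n))))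
      where norm : ∀ j P N → + 0 + j * (P * N) ≡ (+ 0 + j * N) * P
            norm = solve-∀

    cancel0 : ∀ k c z → ¬ (c ≈[ p ] + 0) → c * z ≈[ p ℕ.^ k ] + 0 → z ≈[ p ℕ.^ k ] + 0
    cancel0 zero c z nc h = z , norm z
      where norm : ∀ z → z ≡ + 0 + z * + 1
            norm = solve-∀
    cancel0 (suc k) c z nc h with euclid c z (cweak p (p ℕ.^ k) h)
    ... | inj₁ cc = ⊥-elim (nc cc)
    ... | inj₂ (w , refl) = subst (λ t → t ≈[ p ℕ.^ suc k ] + 0) (sym (+-identityˡ _))
            (mulp (p ℕ.^ k) w (cancel0 k c w nc (cancelp (p ℕ.^ k) (c * w)
              (subst (λ t → t ≈[ p ℕ.^ suc k ] + 0) (norm c w (+ p)) h))))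
      where
        norm : ∀ c w P → c * (+ 0 + w * P) ≡ (c * w) * P
        norm = solve-∀

    cancel : ∀ k c x y → ¬ (c ≈[ p ] + 0) → c * x ≈[ p ℕ.^ k ] c * y → x ≈[ p ℕ.^ k ] y
    cancel k c x y nc h = c0→ (cancel0 k c (x - y) nc
      (subst (λ t → t ≈[ p ℕ.^ k ] + 0) (norm c x y) (→c0 h)))
      where norm : ∀ c x y → c * x - c * y ≡ c * (x - y)
            norm = solve-∀

    cancelModP : ∀ c x y → ¬ (c ≈[ p ] + 0) → c * x ≈[ p ] c * y → x ≈[ p ] y
    cancelModP c x y nc e = cmod (ℕP.*-identityʳ p) (cancel 1 c x y nc (mod1 p e))

    nat≉0 : ∀ n → 0 ℕ.< n → n ℕ.< p → ¬ (+ n ≈[ p ] + 0)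
    nat≉0 (suc n) _ lt h = ℕP.<⇒≱ lt (ℕD.∣⇒≤ (toDiv0 h))

    one≉0 : ¬ (+ 1 ≈[ p ] + 0)
    one≉0 = nat≉0 1 (ℕ.s≤s ℕ.z≤n) p>1

    weak2 : ∀ k {x y} → x ≈[ p ℕ.^ suc (suc k) ] y → x ≈[ p ℕ.^ 2 ] y
    weak2 k {x} {y} e = cweak {x} {y} (p ℕ.^ 2) (p ℕ.^ k) (cmod (ℕP.^-distribˡ-+-* p 2 k) e)

    weak1 : ∀ k {x y} → x ≈[ p ℕ.^ suc k ] y → x ≈[ p ] y
    weak1 k {x} {y} e = cweak {x} {y} p (p ℕ.^ k) e

    pow≥1 : ∀ k → 1 ℕ.≤ p ℕ.^ k
    pow≥1 k = ℕP.m^n>0 p k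

module Frobenius where

  open import Data.Nat as ℕ using (ℕ; zero; suc)
  import Data.Nat.Properties as ℕP
  open import Data.Nat.Combinatorics using (_C_; nCk+nC[k+1]≡[n+1]C[k+1]; nCn≡1; nC1≡n)
  open import Data.Nat.Divisibility as ℕD using (divides)
  open import Data.Nat.Primality using (Prime; euclidsLemma)
  open import Data.Nat.Tactic.RingSolver using (solve-∀)
  open import Data.Fin as Fin using (Fin; zero; suc; toℕ; inject₁; fromℕ)
  open import Data.Fin.Properties using (toℕ-inject₁; toℕ<n; toℕ-fromℕ)
  open import Data.Product using (Σ; _,_)
  open import Data.Sum using (inj₁; inj₂)
  open import Data.Empty using (⊥-elim)
  open import Relation.Binary.PropositionalEquality as ≡ using (_≡_; cong)
  open import Algebra.Bundles using (CommutativeSemiring)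

  absorption : ∀ n k → suc k ℕ.* (suc n C suc k) ≡ suc n ℕ.* (n C k)
  absorption zero zero = ≡.refl
  absorption zero (suc k) = ℕP.*-zeroʳ (suc (suc k))
  absorption (suc n) zero = ≡.trans (ℕP.+-identityʳ _) (≡.trans (nC1≡n (suc (suc n))) (≡.sym (ℕP.*-identityʳ (suc (suc n)))))
  absorption (suc n) (suc k) = begin
      suc (suc k) ℕ.* (suc (suc n) C suc (suc k))
        ≡⟨ cong (suc (suc k) ℕ.*_) (≡.sym (nCk+nC[k+1]≡[n+1]C[k+1] (suc n) (suc k))) ⟩
      suc (suc k) ℕ.* (c₁ ℕ.+ c₂)
        ≡⟨ norm k c₁ c₂ ⟩
      c₁ ℕ.+ (suc k ℕ.* c₁ ℕ.+ suc (suc k) ℕ.* c₂)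
        ≡⟨ cong (c₁ ℕ.+_) (≡.cong₂ ℕ._+_ (absorption n k) (absorption n (suc k))) ⟩
      c₁ ℕ.+ (suc n ℕ.* d₀ ℕ.+ suc n ℕ.* d₁)
        ≡⟨ cong (c₁ ℕ.+_) (≡.sym (ℕP.*-distribˡ-+ (suc n) d₀ d₁)) ⟩
      c₁ ℕ.+ suc n ℕ.* (d₀ ℕ.+ d₁)
        ≡⟨ cong (λ t → c₁ ℕ.+ suc n ℕ.* t) (nCk+nC[k+1]≡[n+1]C[k+1] n k) ⟩
      suc (suc n) ℕ.* c₁ ∎
    where
      open ≡.≡-Reasoning
      c₁ = suc n C suc k
      c₂ = suc n C suc (suc k)
      d₀ = n C k
      d₁ = n C suc k
      norm : ∀ k c₁ c₂ → suc (suc k) ℕ.* (c₁ ℕ.+ c₂) ≡ c₁ ℕ.+ (suc k ℕ.* c₁ ℕ.+ suc (suc k) ℕ.* c₂)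
      norm = solve-∀

  -- p ∣ C(p, j) for 0 < j < p: p divides j·C(p,j) = p·C(p−1,j−1) but not j.
  prime∣binomial : ∀ p → Prime p → ∀ k → suc k ℕ.< p → p ℕD.∣ (p C suc k)
  prime∣binomial (suc n) pp k lt with euclidsLemma (suc k) (suc n C suc k) pp
          (ℕD.divides (n C k) (≡.trans (absorption n k) (ℕP.*-comm (suc n) (n C k))))
  ... | inj₂ d = d
  ... | inj₁ d = ⊥-elim (ℕP.<⇒≱ lt (ℕD.∣⇒≤ d))

  module InSemiring {a ℓ} (S : CommutativeSemiring a ℓ) where
    open CommutativeSemiring S hiding (zero)
    open import Algebra.Properties.CommutativeSemiring.Binomial S using (theorem; binomialTerm)
    open import Algebra.Properties.Semiring.Exp semiring using (_^_)
    open import Algebra.Properties.Monoid.Mult +-monoid using (_×_; ×-assocˡ; ×-homo-1)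
    open import Algebra.Properties.CommutativeMonoid.Mult +-commutativeMonoid using (×-distrib-+)
    open import Algebra.Properties.Monoid.Sum +-monoid using (sum; sum-init-last)
    open import Relation.Binary.Reasoning.Setoid setoid

    Multiple : ℕ → Carrier → Set _
    Multiple q t = Σ Carrier λ z → t ≈ q × z

    ×-zeroʳ : ∀ n → n × 0# ≈ 0#
    ×-zeroʳ zero = refl
    ×-zeroʳ (suc n) = trans (+-identityˡ _) (×-zeroʳ n)

    sumMultiple : ∀ q {n} (t : Fin n → Carrier) → (∀ i → Multiple q (t i)) → Multiple q (sum t)
    sumMultiple q {zero} t h = 0# , sym (×-zeroʳ q)
    sumMultiple q {suc n} t h with h zero | sumMultiple q (λ i → t (suc i)) (λ i → h (suc i))
    ... | z₀ , e₀ | z₁ , e₁ = (z₀ + z₁) , (begin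
        t zero + sum (λ i → t (suc i)) ≈⟨ +-cong e₀ e₁ ⟩
        q × z₀ + q × z₁ ≈⟨ sym (×-distrib-+ z₀ z₁ q) ⟩
        q × (z₀ + z₁) ∎)

    lastTerm : ∀ x y p j → j ≡ p → (p C j) × ((x ^ j) * (y ^ (p ℕ.∸ j))) ≈ x ^ p
    lastTerm x y p .p ≡.refl = begin
      (p C p) × ((x ^ p) * (y ^ (p ℕ.∸ p))) ≡⟨ cong (λ t → (p C p) × ((x ^ p) * (y ^ t))) (ℕP.n∸n≡0 p) ⟩
      (p C p) × ((x ^ p) * 1#) ≡⟨ cong (λ t → t × ((x ^ p) * 1#)) (nCn≡1 p) ⟩
      1 × ((x ^ p) * 1#) ≈⟨ ×-homo-1 _ ⟩
      (x ^ p) * 1# ≈⟨ *-identityʳ _ ⟩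
      x ^ p ∎

    firstTerm : ∀ x y p → (p C 0) × ((x ^ 0) * (y ^ (p ℕ.∸ 0))) ≈ y ^ p
    firstTerm x y p = begin
      1 × (1# * (y ^ p)) ≈⟨ ×-homo-1 _ ⟩
      1# * (y ^ p) ≈⟨ *-identityˡ _ ⟩
      y ^ p ∎

    innerTerm : ∀ p → Prime p → ∀ x y j → suc j ℕ.< p →
                Multiple p ((p C suc j) × ((x ^ suc j) * (y ^ (p ℕ.∸ suc j))))
    innerTerm p pp x y j lt with prime∣binomial p pp j lt
    ... | divides q e = q × w , (begin
        (p C suc j) × w ≡⟨ cong (_× w) e ⟩
        (q ℕ.* p) × w ≡⟨ cong (_× w) (ℕP.*-comm q p) ⟩
        (p ℕ.* q) × w ≈⟨ sym (×-assocˡ w p q) ⟩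
        p × (q × w) ∎)
      where w = (x ^ suc j) * (y ^ (p ℕ.∸ suc j))

    frobenius : ∀ p → Prime p → ∀ x y → Σ Carrier λ z → (x + y) ^ p ≈ x ^ p + y ^ p + p × z
    frobenius (suc n) pp x y with sumMultiple (suc n) (λ i → binomialTerm x y (suc n) (suc (inject₁ i)))
                           (λ i → innerTerm (suc n) pp x y (toℕ (inject₁ i))
                                    (ℕ.s≤s (≡.subst (ℕ._< n) (≡.sym (toℕ-inject₁ i)) (toℕ<n i))))
    ... | z , ez = z , (begin
        (x + y) ^ p ≈⟨ theorem p x y ⟩
        term Fin.zero + sum (λ i → term (suc i)) ≈⟨ +-cong (firstTerm x y p) (sum-init-last (λ i → term (suc i))) ⟩
        y ^ p + (inner + term (suc (fromℕ n))) ≈⟨ +-congˡ (+-cong ez (lastTerm x y p (suc (toℕ (fromℕ n))) (cong suc (toℕ-fromℕ n)))) ⟩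
        y ^ p + (p × z + x ^ p) ≈⟨ +-congˡ (+-comm _ _) ⟩
        y ^ p + (x ^ p + p × z) ≈⟨ sym (+-assoc _ _ _) ⟩
        y ^ p + x ^ p + p × z ≈⟨ +-congʳ (+-comm _ _) ⟩
        x ^ p + y ^ p + p × z ∎)
      where
        p = suc n
        term = binomialTerm x y p
        inner = sum (λ i → term (suc (inject₁ i)))

-- Fermat's little theorem x^p ≡ x (mod p) for integers: by Frobenius and
-- induction for naturals, then for x through its residue x mod p.
module Fermat where

  open import Data.Nat as ℕ using (ℕ; zero; suc)
  open import Data.Nat.Primality using (Prime)
  open import Data.Integer as ℤ using (+_; _+_; _*_; _^_; _%ℕ_; _/ℕ_)
  open import Data.Integer.Properties using (+-*-commutativeSemiring; pos-+; ^-zeroˡ; *-comm)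
  open import Data.Integer.DivMod using (a≡a%ℕn+[a/ℕn]*n)
  open import Data.Integer.Tactic.RingSolver
  open import Data.Product using (_,_)
  open import Relation.Binary.PropositionalEquality
  open import Algebra.Bundles using (CommutativeSemiring)
  open Congruence

  module ℤS = CommutativeSemiring +-*-commutativeSemiring
  open import Algebra.Properties.Monoid.Mult ℤS.+-monoid using (_×_)
  open import Algebra.Properties.Semiring.Exp ℤS.semiring using () renaming (_^_ to _^S_)

  ^S≡^ : ∀ z n → z ^S n ≡ z ^ n
  ^S≡^ z zero = refl
  ^S≡^ z (suc n) = cong (z *_) (^S≡^ z n)

  ×≡* : ∀ n z → n × z ≡ + n * z
  ×≡* zero z = refl
  ×≡* (suc n) z = trans (cong (λ t → z + t) (×≡* n z)) (norm z (+ n))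
    where norm : ∀ z N → z + N * z ≡ (+ 1 + N) * z
          norm = solve-∀

  frobeniusℤ : ∀ p → Prime p → ∀ x y → (x + y) ^ p ≈[ p ] x ^ p + y ^ p
  frobeniusℤ p pp x y with Frobenius.InSemiring.frobenius +-*-commutativeSemiring p pp x y
  ... | z , e = z , (begin
      (x + y) ^ p ≡⟨ sym (^S≡^ (x + y) p) ⟩
      (x + y) ^S p ≡⟨ e ⟩
      x ^S p + y ^S p + p × z ≡⟨ cong₂ (λ a b → a + b + p × z) (^S≡^ x p) (^S≡^ y p) ⟩
      x ^ p + y ^ p + p × z ≡⟨ cong (λ t → x ^ p + y ^ p + t) (trans (×≡* p z) (*-comm (+ p) z)) ⟩
      x ^ p + y ^ p + z * + p ∎)
    where open ≡-Reasoning

  fermatℕ : ∀ p → Prime p → ∀ n → (+ n) ^ p ≈[ p ] + n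
  fermatℕ p pp zero = ceq (0^p p)
    where open ModPrime p pp
          0^p : ∀ p → {{ℕ.NonZero p}} → (+ 0) ^ p ≡ + 0
          0^p (suc p) = refl
  fermatℕ p pp (suc n) = ctrans (frobeniusℤ p pp (+ 1) (+ n))
    (subst (λ t → (+ 1) ^ p + (+ n) ^ p ≈[ p ] t) (sym (pos-+ 1 n))
      (c+ (ceq (^-zeroˡ p)) (fermatℕ p pp n)))

  fermat : ∀ p → Prime p → ∀ x → x ^ p ≈[ p ] x
  fermat p pp x = ctrans (c^ p x≈r) (ctrans (fermatℕ p pp (x %ℕ p)) (csym x≈r))
    where
      open ModPrime p pp
      x≈r : x ≈[ p ] + (x %ℕ p)
      x≈r = (x /ℕ p) , a≡a%ℕn+[a/ℕn]*n x p

-- Euler's criterion d^((p−1)/2) ≡ (d/p) (mod p) for an odd prime p, where the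
-- non-residue case uses Lagrange's bound on the number of roots of a monic
-- polynomial modulo p.
module Euler where

  open import Data.Nat as ℕ using (ℕ; zero; suc; z≤n; s≤s)
  import Data.Nat.Properties as ℕP
  import Data.Nat.Divisibility as ℕD
  open import Data.Nat.Primality using (Prime)
  open import Data.Integer as ℤ using (ℤ; +_; _+_; _-_; _*_; -_; _^_; ∣_∣)
  open import Data.Integer.Properties using (pos-+; ^-distribˡ-+-*)
  open import Data.Integer.Tactic.RingSolver
  open import Data.Integer.Divisibility using (_∣_)
  open import Data.List using (List; []; _∷_; length; upTo)
  open import Data.List.Relation.Unary.All using (All; []; _∷_)
  open import Data.List.Relation.Unary.Any as Any using (any?)
  open import Data.List.Membership.Propositional.Properties using (∈-upTo⁺)
  open import Data.Product using (Σ; _,_; _×_; proj₁; proj₂)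
  open import Data.Sum using (_⊎_; inj₁; inj₂)
  open import Data.Unit using (⊤; tt)
  open import Data.Empty using (⊥-elim)
  open import Relation.Nullary using (¬_; yes; no)
  open import Relation.Binary.PropositionalEquality
  open import Defs using (legendre)
  open Congruence
  open Fermat

  -- Monic integer polynomials of degree n in Horner form.
  infixl 4 _,,_
  data Monic : ℕ → Set where
    one : Monic 0
    _,,_ : ∀ {n} → Monic n → ℤ → Monic (suc n)

  eval : ∀ {n} → Monic n → ℤ → ℤ
  eval one t = + 1
  eval (f ,, a) t = eval f t * t + a

  quot : ∀ {n} → Monic (suc n) → ℤ → Monic n
  quot (one ,, a) r = one
  quot ((g ,, b) ,, a) r = quot (g ,, b) r ,, eval (g ,, b) r

  division : ∀ {n} (f : Monic (suc n)) r t → eval f t ≡ (t - r) * eval (quot f r) t + eval f r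
  division (one ,, a) r t = norm t r a
    where norm : ∀ t r a → + 1 * t + a ≡ (t - r) * + 1 + (+ 1 * r + a)
          norm = solve-∀
  division ((g ,, b) ,, a) r t = trans (cong (λ z → z * t + a) (division (g ,, b) r t))
    (norm t r a (eval (quot (g ,, b) r) t) (eval (g ,, b) r))
    where norm : ∀ t r a Q F → ((t - r) * Q + F) * t + a ≡ (t - r) * (Q * t + F) + (F * r + a)
          norm = solve-∀

  module RootBound (p : ℕ) (pp : Prime p) where
    open ModPrime p pp

    Distinct : List ℤ → Set
    Distinct [] = ⊤
    Distinct (r ∷ rs) = All (λ s → ¬ (s - r ≈[ p ] + 0)) rs × Distinct rs

    rootBound : ∀ {n} (f : Monic n) (rs : List ℤ) → Distinct rs → All (λ r → eval f r ≈[ p ] + 0) rs → length rs ℕ.≤ n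
    rootBound f [] _ _ = z≤n
    rootBound one (r ∷ rs) _ (h ∷ _) = ⊥-elim (one≉0 h)
    rootBound (f ,, a) (r ∷ rs) (nd , d) (h ∷ hs) = s≤s (rootBound (quot F r) rs d (quotRoots rs nd hs))
      where
        F = f ,, a
        quotRoots : ∀ ss → All (λ s → ¬ (s - r ≈[ p ] + 0)) ss → All (λ s → eval F s ≈[ p ] + 0) ss
                  → All (λ s → eval (quot F r) s ≈[ p ] + 0) ss
        quotRoots [] _ _ = []
        quotRoots (s ∷ ss) (n ∷ ns) (e ∷ es) = root ∷ quotRoots ss ns es
          where
            norm : ∀ a b c → a ≡ c + b → a - b ≡ c
            norm a b c refl = cancel-+ b c
              where cancel-+ : ∀ b c → c + b - b ≡ c
                    cancel-+ = solve-∀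
            product : (s - r) * eval (quot F r) s ≈[ p ] + 0
            product = subst (_≈[ p ] + 0) (norm _ _ _ (division F r s)) (c- e h)
            root : eval (quot F r) s ≈[ p ] + 0
            root with euclid (s - r) (eval (quot F r) s) product
            ... | inj₁ z = ⊥-elim (n z)
            ... | inj₂ z = z

  xⁿ-1 : ∀ n → 1 ℕ.≤ n → Σ (Monic n) (λ f → ∀ t → eval f t ≡ t ^ n - + 1)
  xⁿ-1 (suc n) _ = (xpow n ,, - (+ 1)) , λ t → trans (cong (λ z → z * t + - (+ 1)) (eval-xpow n t)) (norm (t ^ n) t)
    where
      xpow : ∀ n → Monic n
      xpow zero = one
      xpow (suc n) = xpow n ,, + 0
      eval-xpow : ∀ n t → eval (xpow n) t ≡ t ^ n
      eval-xpow zero t = refl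
      eval-xpow (suc n) t = trans (cong (λ z → z * t + + 0) (eval-xpow n t)) (norm' (t ^ n) t)
        where norm' : ∀ a t → a * t + + 0 ≡ t * a
              norm' = solve-∀
      norm : ∀ a t → a * t + - (+ 1) ≡ t * a - + 1
      norm = solve-∀

  ^-distribʳ-* : ∀ x y n → (x * y) ^ n ≡ x ^ n * y ^ n
  ^-distribʳ-* x y zero = refl
  ^-distribʳ-* x y (suc n) = trans (cong (x * y *_) (^-distribʳ-* x y n)) (norm x y (x ^ n) (y ^ n))
    where norm : ∀ x y a b → x * y * (a * b) ≡ x * a * (y * b)
          norm = solve-∀

  sq : ℕ → ℤ
  sq x = + x * + x

  module Criterion (p : ℕ) (pp : Prime p) (h : ℕ) (hp : p ≡ suc (h ℕ.+ h)) where
    open ModPrime p pp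
    open RootBound p pp

    h<p : h ℕ.< p
    h<p = subst (h ℕ.<_) (sym hp) (s≤s (ℕP.m≤m+n h h))

    h≥1 : 1 ℕ.≤ h
    h≥1 = positive h hp
      where positive : ∀ h → p ≡ suc (h ℕ.+ h) → 1 ℕ.≤ h
            positive zero e = ⊥-elim (ℕP.<⇒≢ p>1 (sym e))
            positive (suc _) _ = s≤s z≤n

    fermat-unit : ∀ x → ¬ (x ≈[ p ] + 0) → x ^ (h ℕ.+ h) ≈[ p ] + 1
    fermat-unit x nx = cancelModP x (x ^ (h ℕ.+ h)) (+ 1) nx
        (ctrans (subst (λ e → x ^ e ≈[ p ] x) hp (fermat p pp x)) (ceq (sym (norm x))))
      where norm : ∀ x → x * + 1 ≡ x
            norm = solve-∀

    sq^h : ∀ x → sq x ^ h ≡ (+ x) ^ (h ℕ.+ h)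
    sq^h x = trans (^-distribʳ-* (+ x) (+ x) h) (sym (^-distribˡ-+-* (+ x) h h))

    -- The squares 1², …, h² are pairwise incongruent: j² − x² = −(x−j)(x+j).
    squares : ℕ → List ℤ
    squares zero = []
    squares (suc k) = sq (suc k) ∷ squares k

    length-squares : ∀ k → length (squares k) ≡ k
    length-squares zero = refl
    length-squares (suc k) = cong suc (length-squares k)

    sq-difference : ∀ j e → sq j - sq (e ℕ.+ j) ≡ - (+ e * + (e ℕ.+ j ℕ.+ j))
    sq-difference j e = trans (cong (λ z → sq j - z * z) (pos-+ e j))
      (trans (norm (+ j) (+ e)) (cong (λ z → - (+ e * z)) (sym (pos-+ (e ℕ.+ j) j))))
      where norm : ∀ J E → J * J - (E + J) * (E + J) ≡ - (E * (E + J + J))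
            norm = solve-∀

    squares-differ : ∀ j x → 0 ℕ.< j → j ℕ.< x → x ℕ.≤ h → ¬ (sq j - sq x ≈[ p ] + 0)
    squares-differ j x j>0 j<x x≤h hyp with euclid (+ e) (+ (e ℕ.+ j ℕ.+ j)) product
      where
        e = x ℕ.∸ j
        x≡e+j : e ℕ.+ j ≡ x
        x≡e+j = ℕP.m∸n+n≡m (ℕP.<⇒≤ j<x)
        norm : ∀ z → - - z ≡ z
        norm = solve-∀
        product : + e * + (e ℕ.+ j ℕ.+ j) ≈[ p ] + 0
        product = subst (_≈[ p ] + 0) (norm _) (cneg (subst (_≈[ p ] + 0) (sq-difference j e)
                    (subst (λ z → sq j - sq z ≈[ p ] + 0) (sym x≡e+j) hyp)))
    ... | inj₁ z = nat≉0 (x ℕ.∸ j) (ℕP.m<n⇒0<n∸m j<x) (ℕP.≤-<-trans (ℕP.m∸n≤m x j) (ℕP.≤-<-trans x≤h h<p)) z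
    ... | inj₂ z = nat≉0 (x ℕ.∸ j ℕ.+ j ℕ.+ j) (ℕP.<-≤-trans j>0 (ℕP.m≤n+m j _)) small z
      where
        small : x ℕ.∸ j ℕ.+ j ℕ.+ j ℕ.< p
        small = subst (λ z → z ℕ.+ j ℕ.< p) (sym (ℕP.m∸n+n≡m (ℕP.<⇒≤ j<x)))
                  (subst (x ℕ.+ j ℕ.<_) (sym hp) (s≤s (ℕP.+-mono-≤ x≤h (ℕP.≤-trans (ℕP.<⇒≤ j<x) x≤h))))

    distinctSquares : ∀ k → k ℕ.≤ h → Distinct (squares k)
    distinctSquares zero _ = tt
    distinctSquares (suc k) le = below k (ℕP.n<1+n k) , distinctSquares k (ℕP.<⇒≤ le)
      where below : ∀ j → j ℕ.< suc k → All (λ s → ¬ (s - sq (suc k) ≈[ p ] + 0)) (squares j)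
            below zero _ = []
            below (suc j) lt = squares-differ (suc j) (suc k) (s≤s z≤n) lt le ∷ below j (ℕP.<-trans (ℕP.n<1+n j) lt)

    G = proj₁ (xⁿ-1 h h≥1)
    evalG = proj₂ (xⁿ-1 h h≥1)

    sub1 : ∀ {a} → a ≈[ p ] + 1 → a - + 1 ≈[ p ] + 0
    sub1 e = c- e (crefl {p} {+ 1})

    squaresRoots : ∀ k → k ℕ.≤ h → All (λ r → eval G r ≈[ p ] + 0) (squares k)
    squaresRoots zero _ = []
    squaresRoots (suc k) le = root ∷ squaresRoots k (ℕP.<⇒≤ le)
      where root = subst (_≈[ p ] + 0) (sym (trans (evalG (sq (suc k))) (cong (_- + 1) (sq^h (suc k)))))
                     (sub1 (fermat-unit (+ suc k) (nat≉0 (suc k) (s≤s z≤n) (ℕP.≤-<-trans le h<p))))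

    nonresidue : ∀ d → ¬ (d ≈[ p ] + 0) → (∀ x → 0 ℕ.< x → x ℕ.≤ h → ¬ (d - sq x ≈[ p ] + 0)) → d ^ h ≈[ p ] - (+ 1)
    nonresidue d nd ns = conclude (euclid (d ^ h - + 1) (d ^ h + + 1) product)
      where
        -- (d^h − 1)(d^h + 1) = d^(p−1) − 1 ≡ 0.
        product : (d ^ h - + 1) * (d ^ h + + 1) ≈[ p ] + 0
        product = subst (_≈[ p ] + 0) (trans (cong (_- + 1) (^-distribˡ-+-* d h h)) (norm (d ^ h)))
                    (sub1 (fermat-unit d nd))
          where norm : ∀ a → a * a - + 1 ≡ (a - + 1) * (a + + 1)
                norm = solve-∀
        notSquare : ∀ k → k ℕ.≤ h → All (λ s → ¬ (s - d ≈[ p ] + 0)) (squares k)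
        notSquare zero _ = []
        notSquare (suc k) le = (λ e → ns (suc k) (s≤s z≤n) le (→c0 {x = d} {y = sq (suc k)} (csym (c0→ {x = sq (suc k)} {y = d} e)))) ∷ notSquare k (ℕP.<⇒≤ le)
        -- If d^h ≡ 1 then d, 1², …, h² would be h + 1 distinct roots of t^h − 1.
        notOne : ¬ (d ^ h - + 1 ≈[ p ] + 0)
        notOne z = ℕP.<⇒≱ (ℕP.n<1+n h) (subst (λ n → suc n ℕ.≤ h) (length-squares h)
          (rootBound G (d ∷ squares h) (notSquare h ℕP.≤-refl , distinctSquares h ℕP.≤-refl)
            (subst (_≈[ p ] + 0) (sym (evalG d)) z ∷ squaresRoots h ℕP.≤-refl)))
        conclude : (d ^ h - + 1 ≈[ p ] + 0) ⊎ (d ^ h + + 1 ≈[ p ] + 0) → d ^ h ≈[ p ] - (+ 1)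
        conclude (inj₁ z) = ⊥-elim (notOne z)
        conclude (inj₂ z) = c0→ (subst (_≈[ p ] + 0) (norm (d ^ h)) z)
          where norm : ∀ a → a + + 1 ≡ a - - (+ 1)
                norm = solve-∀

    residue : ∀ d x → d - sq x ≈[ p ] + 0 → ¬ (d ≈[ p ] + 0) → d ^ h ≈[ p ] + 1
    residue d x e nd = ctrans (c^ h (c0→ e)) (subst (_≈[ p ] + 1) (sym (sq^h x)) (fermat-unit (+ x) nx))
      where
        nx : ¬ (+ x ≈[ p ] + 0)
        nx z = nd (ctrans (c0→ e) (c* z z))

    divisible : ∀ d → d ≈[ p ] + 0 → d ^ h ≈[ p ] + 0
    divisible d e = go h h≥1
      where go : ∀ n → 1 ℕ.≤ n → d ^ n ≈[ p ] + 0
            go (suc n) _ = subst (d ^ suc n ≈[ p ]_) (norm (d ^ n)) (c* e (crefl {p} {d ^ n}))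
              where norm : ∀ a → + 0 * a ≡ + 0
                    norm = solve-∀

  eulerCriterion : ∀ p → Prime p → ∀ h → p ≡ suc (h ℕ.+ h) → ∀ d → d ^ h ≈[ p ] legendre p d
  eulerCriterion p pp h hp d with p ℕD.∣? ∣ d ∣
  ... | yes dv = Criterion.divisible p pp h hp d (fromDiv {d} dv)
  ... | no ndv with any? (λ x → p ℕD.∣? ∣ d - (+ x) * (+ x) ∣) (upTo p)
  ...   | yes an = Criterion.residue p pp h hp d (proj₁ (Any.satisfied an)) (fromDiv (proj₂ (Any.satisfied an))) (λ z → ndv (toDiv0 z))
  ...   | no nan = Criterion.nonresidue p pp h hp d (λ z → ndv (toDiv0 z))
            (λ x x>0 x≤h z → nan (Any.map (λ { refl → toDiv0 z }) (∈-upTo⁺ (ℕP.≤-<-trans x≤h (Criterion.h<p p pp h hp)))))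

  legendre-cases : ∀ p d → legendre p d ≡ + 0 ⊎ legendre p d ≡ + 1 ⊎ legendre p d ≡ - (+ 1)
  legendre-cases p d with p ℕD.∣? ∣ d ∣
  ... | yes _ = inj₁ refl
  ... | no _ with any? (λ x → p ℕD.∣? ∣ d - (+ x) * (+ x) ∣) (upTo p)
  ...   | yes _ = inj₂ (inj₁ refl)
  ...   | no _ = inj₂ (inj₂ refl)

  legendre-unit : ∀ p d → ¬ ((+ p) ∣ d) → legendre p d ≡ + 1 ⊎ legendre p d ≡ - (+ 1)
  legendre-unit p d nd with p ℕD.∣? ∣ d ∣
  ... | yes dv = ⊥-elim (nd dv)
  ... | no _ with any? (λ x → p ℕD.∣? ∣ d - (+ x) * (+ x) ∣) (upTo p)
  ...   | yes _ = inj₁ refl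
  ...   | no _ = inj₂ refl

-- The ring ℤ[α] = ℤ[x]/(x² − A x + B): an element a + bα is the pair mk a b,
-- with α² = Aα − B.  Congruence modulo m is taken coordinatewise.
module QuadraticRing (A B : Data.Integer.ℤ) where
  open import Data.Nat as ℕ using (ℕ; zero; suc)
  import Data.Nat.Properties as ℕP
  open import Data.Nat.Primality using (Prime)
  open import Data.Integer as ℤ using (ℤ; +_; _+_; _-_; _*_; -_; _^_)
  open import Data.Integer.Properties using (pos-*)
  open import Data.Integer.Tactic.RingSolver
  open import Data.Product using (Σ; _,_)
  open import Relation.Binary.PropositionalEquality
  open import Algebra.Bundles using (CommutativeSemiring)
  open import Algebra.Structures using (IsCommutativeMonoid)
  open import Algebra.Structures.Biased using (IsCommutativeSemiringˡ)
  open Congruence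

  record ℤ[α] : Set where
    constructor mk
    field
      re im : ℤ
  open ℤ[α] public

  mk-cong : ∀ {a b c d} → a ≡ c → b ≡ d → mk a b ≡ mk c d
  mk-cong refl refl = refl

  infixl 6 _⊕_
  infixl 7 _⊗_

  _⊕_ : ℤ[α] → ℤ[α] → ℤ[α]
  mk a b ⊕ mk c d = mk (a + c) (b + d)

  _⊗_ : ℤ[α] → ℤ[α] → ℤ[α]
  mk a b ⊗ mk c d = mk (a * c - B * b * d) (a * d + b * c + A * b * d)

  0R 1R : ℤ[α]
  0R = mk (+ 0) (+ 0)
  1R = mk (+ 1) (+ 0)

  ⊕-assoc : ∀ x y z → (x ⊕ y) ⊕ z ≡ x ⊕ (y ⊕ z)
  ⊕-assoc (mk a b) (mk c d) (mk e f) = mk-cong (norm a c e) (norm b d f)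
    where norm : ∀ a c e → a + c + e ≡ a + (c + e)
          norm = solve-∀
  ⊕-comm : ∀ x y → x ⊕ y ≡ y ⊕ x
  ⊕-comm (mk a b) (mk c d) = mk-cong (norm a c) (norm b d)
    where norm : ∀ a c → a + c ≡ c + a
          norm = solve-∀
  ⊕-identityˡ : ∀ x → 0R ⊕ x ≡ x
  ⊕-identityˡ (mk a b) = mk-cong (norm a) (norm b)
    where norm : ∀ a → + 0 + a ≡ a
          norm = solve-∀
  ⊕-identityʳ : ∀ x → x ⊕ 0R ≡ x
  ⊕-identityʳ x = trans (⊕-comm x 0R) (⊕-identityˡ x)

  ⊗-assoc : ∀ x y z → (x ⊗ y) ⊗ z ≡ x ⊗ (y ⊗ z)
  ⊗-assoc (mk a b) (mk c d) (mk e f) = mk-cong (norm₁ a b c d e f A B) (norm₂ a b c d e f A B)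
    where norm₁ : ∀ a b c d e f A B → (a * c - B * b * d) * e - B * (a * d + b * c + A * b * d) * f
                   ≡ a * (c * e - B * d * f) - B * b * (c * f + d * e + A * d * f)
          norm₁ = solve-∀
          norm₂ : ∀ a b c d e f A B → (a * c - B * b * d) * f + (a * d + b * c + A * b * d) * e + A * (a * d + b * c + A * b * d) * f
                   ≡ a * (c * f + d * e + A * d * f) + b * (c * e - B * d * f) + A * b * (c * f + d * e + A * d * f)
          norm₂ = solve-∀
  ⊗-comm : ∀ x y → x ⊗ y ≡ y ⊗ x
  ⊗-comm (mk a b) (mk c d) = mk-cong (norm₁ a b c d B) (norm₂ a b c d A)
    where norm₁ : ∀ a b c d B → a * c - B * b * d ≡ c * a - B * d * b
          norm₁ = solve-∀
          norm₂ : ∀ a b c d A → a * d + b * c + A * b * d ≡ c * b + d * a + A * d * b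
          norm₂ = solve-∀
  ⊗-identityˡ : ∀ x → 1R ⊗ x ≡ x
  ⊗-identityˡ (mk a b) = mk-cong (norm₁ a b B) (norm₂ a b A)
    where norm₁ : ∀ a b B → + 1 * a - B * + 0 * b ≡ a
          norm₁ = solve-∀
          norm₂ : ∀ a b A → + 1 * b + + 0 * a + A * + 0 * b ≡ b
          norm₂ = solve-∀
  ⊗-identityʳ : ∀ x → x ⊗ 1R ≡ x
  ⊗-identityʳ x = trans (⊗-comm x 1R) (⊗-identityˡ x)
  ⊗-distribʳ : ∀ x y z → (y ⊕ z) ⊗ x ≡ y ⊗ x ⊕ z ⊗ x
  ⊗-distribʳ (mk a b) (mk c d) (mk e f) = mk-cong (norm₁ a b c d e f B) (norm₂ a b c d e f A)
    where norm₁ : ∀ a b c d e f B → (c + e) * a - B * (d + f) * b ≡ c * a - B * d * b + (e * a - B * f * b)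
          norm₁ = solve-∀
          norm₂ : ∀ a b c d e f A → (c + e) * b + (d + f) * a + A * (d + f) * b ≡ c * b + d * a + A * d * b + (e * b + f * a + A * f * b)
          norm₂ = solve-∀
  ⊗-zeroˡ : ∀ x → 0R ⊗ x ≡ 0R
  ⊗-zeroˡ (mk a b) = mk-cong (norm₁ a b B) (norm₂ a b A)
    where norm₁ : ∀ a b B → + 0 * a - B * + 0 * b ≡ + 0
          norm₁ = solve-∀
          norm₂ : ∀ a b A → + 0 * b + + 0 * a + A * + 0 * b ≡ + 0
          norm₂ = solve-∀

  isCommutativeMonoid : ∀ (_∙_ : ℤ[α] → ℤ[α] → ℤ[α]) e → (∀ x y z → (x ∙ y) ∙ z ≡ x ∙ (y ∙ z))
    → (∀ x → e ∙ x ≡ x) → (∀ x → x ∙ e ≡ x) → (∀ x y → x ∙ y ≡ y ∙ x) → IsCommutativeMonoid _≡_ _∙_ e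
  isCommutativeMonoid _∙_ e assoc idˡ idʳ comm = record
    { isMonoid = record
      { isSemigroup = record
        { isMagma = record { isEquivalence = isEquivalence ; ∙-cong = cong₂ _∙_ }
        ; assoc = assoc }
      ; identity = idˡ , idʳ }
    ; comm = comm }

  semiring : CommutativeSemiring _ _
  semiring = record
    { Carrier = ℤ[α] ; _≈_ = _≡_ ; _+_ = _⊕_ ; _*_ = _⊗_ ; 0# = 0R ; 1# = 1R
    ; isCommutativeSemiring = IsCommutativeSemiringˡ.isCommutativeSemiring (record
        { +-isCommutativeMonoid = isCommutativeMonoid _⊕_ 0R ⊕-assoc ⊕-identityˡ ⊕-identityʳ ⊕-comm
        ; *-isCommutativeMonoid = isCommutativeMonoid _⊗_ 1R ⊗-assoc ⊗-identityˡ ⊗-identityʳ ⊗-comm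
        ; distribʳ = ⊗-distribʳ
        ; zeroˡ = ⊗-zeroˡ }) }

  module RS = CommutativeSemiring semiring
  open import Algebra.Properties.Semiring.Exp RS.semiring public using () renaming (_^_ to _^R_)
  open import Algebra.Properties.Monoid.Mult RS.+-monoid using () renaming (_×_ to _×R_)
  import Algebra.Properties.Monoid.Mult RS.*-monoid as PowerLaws
  import Algebra.Properties.CommutativeMonoid.Mult RS.*-commutativeMonoid as CommPowerLaws

  ^R-* : ∀ z m n → (z ^R m) ^R n ≡ z ^R (n ℕ.* m)
  ^R-* z m n = PowerLaws.×-assocˡ z n m

  ^R-+ : ∀ z m n → z ^R (m ℕ.+ n) ≡ z ^R m ⊗ z ^R n
  ^R-+ z m n = PowerLaws.×-homo-+ z m n

  ^R-⊗ : ∀ x y n → (x ⊗ y) ^R n ≡ x ^R n ⊗ y ^R n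
  ^R-⊗ x y n = CommPowerLaws.×-distrib-+ x y n

  scale : ℤ → ℤ[α] → ℤ[α]
  scale D (mk a b) = mk (a * D) (b * D)

  scal : ℤ → ℤ[α]
  scal c = mk c (+ 0)

  ×R≡scale : ∀ n z → n ×R z ≡ scale (+ n) z
  ×R≡scale zero (mk a b) = mk-cong (norm a) (norm b)
    where norm : ∀ a → + 0 ≡ a * + 0
          norm = solve-∀
  ×R≡scale (suc n) (mk a b) = trans (cong (mk a b ⊕_) (×R≡scale n (mk a b))) (mk-cong (norm a (+ n)) (norm b (+ n)))
    where norm : ∀ a N → a + a * N ≡ a * (+ 1 + N)
          norm = solve-∀

  scalPow : ∀ c n → scal c ^R n ≡ scal (c ^ n)
  scalPow c zero = refl
  scalPow c (suc n) = trans (cong (scal c ⊗_) (scalPow c n)) (mk-cong (norm₁ c (c ^ n) B) (norm₂ c (c ^ n) A))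
    where norm₁ : ∀ c d B → c * d - B * + 0 * + 0 ≡ c * d
          norm₁ = solve-∀
          norm₂ : ∀ c d A → c * + 0 + + 0 * d + A * + 0 * + 0 ≡ + 0
          norm₂ = solve-∀

  infix 4 _≈R[_]_
  record _≈R[_]_ (x : ℤ[α]) (m : ℕ) (y : ℤ[α]) : Set where
    constructor _&_
    field
      cre : re x ≈[ m ] re y
      cim : im x ≈[ m ] im y
  open _≈R[_]_ public

  module _ {m : ℕ} where
    rrefl : ∀ {x} → x ≈R[ m ] x
    rrefl = crefl & crefl
    req : ∀ {x y} → x ≡ y → x ≈R[ m ] y
    req refl = rrefl
    rtrans : ∀ {x y z} → x ≈R[ m ] y → y ≈R[ m ] z → x ≈R[ m ] z
    rtrans (a & b) (c & d) = ctrans a c & ctrans b d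

  frobeniusR : ∀ p → Prime p → ∀ x y → (x ⊕ y) ^R p ≈R[ p ] x ^R p ⊕ y ^R p
  frobeniusR p pp x y with Frobenius.InSemiring.frobenius semiring p pp x y
  ... | z , e = split (x ^R p ⊕ y ^R p) (trans e (cong ((x ^R p ⊕ y ^R p) ⊕_) (×R≡scale p z)))
    where split : ∀ W → (x ⊕ y) ^R p ≡ W ⊕ scale (+ p) z → (x ⊕ y) ^R p ≈R[ p ] W
          split (mk a b) e' = (re z , cong re e') & (im z , cong im e')

  -- Lifting.  Write x = y + D·c.  Then (y + D c)^n = y^n + D·T_n + D²·E with
  -- T_n = n·c·y^(n−1), hence x ≡ y (mod p d) implies x^p ≡ y^p (mod p² d).
  firstOrder : ℤ[α] → ℤ[α] → ℕ → ℤ[α]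
  firstOrder y c zero = 0R
  firstOrder y c (suc n) = y ⊗ firstOrder y c n ⊕ c ⊗ y ^R n

  expandStep : ∀ y c Y U E D → (y ⊕ scale D c) ⊗ (Y ⊕ scale D U ⊕ scale (D * D) E)
            ≡ y ⊗ Y ⊕ scale D (y ⊗ U ⊕ c ⊗ Y) ⊕ scale (D * D) (c ⊗ U ⊕ y ⊗ E ⊕ scale D (c ⊗ E))
  expandStep (mk y1 y2) (mk c1 c2) (mk Y1 Y2) (mk U1 U2) (mk E1 E2) D =
    mk-cong (norm₁ y1 y2 c1 c2 Y1 Y2 U1 U2 E1 E2 D A B) (norm₂ y1 y2 c1 c2 Y1 Y2 U1 U2 E1 E2 D A B)
    where
      norm₁ : ∀ y1 y2 c1 c2 Y1 Y2 U1 U2 E1 E2 D A B →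
           (y1 + c1 * D) * (Y1 + U1 * D + E1 * (D * D)) - B * (y2 + c2 * D) * (Y2 + U2 * D + E2 * (D * D))
           ≡ y1 * Y1 - B * y2 * Y2 + (y1 * U1 - B * y2 * U2 + (c1 * Y1 - B * c2 * Y2)) * D
             + (c1 * U1 - B * c2 * U2 + (y1 * E1 - B * y2 * E2) + (c1 * E1 - B * c2 * E2) * D) * (D * D)
      norm₁ = solve-∀
      norm₂ : ∀ y1 y2 c1 c2 Y1 Y2 U1 U2 E1 E2 D A B →
           (y1 + c1 * D) * (Y2 + U2 * D + E2 * (D * D)) + (y2 + c2 * D) * (Y1 + U1 * D + E1 * (D * D))
             + A * (y2 + c2 * D) * (Y2 + U2 * D + E2 * (D * D))
           ≡ y1 * Y2 + y2 * Y1 + A * y2 * Y2 + (y1 * U2 + y2 * U1 + A * y2 * U2 + (c1 * Y2 + c2 * Y1 + A * c2 * Y2)) * D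
             + (c1 * U2 + c2 * U1 + A * c2 * U2 + (y1 * E2 + y2 * E1 + A * y2 * E2) + (c1 * E2 + c2 * E1 + A * c2 * E2) * D) * (D * D)
      norm₂ = solve-∀

  expand : ∀ y c D n → Σ ℤ[α] λ E → (y ⊕ scale D c) ^R n ≡ y ^R n ⊕ scale D (firstOrder y c n) ⊕ scale (D * D) E
  expand y c D zero = 0R , mk-cong (norm₁ D) (norm₂ D)
    where norm₁ : ∀ D → + 1 ≡ + 1 + + 0 * D + + 0 * (D * D)
          norm₁ = solve-∀
          norm₂ : ∀ D → + 0 ≡ + 0 + + 0 * D + + 0 * (D * D)
          norm₂ = solve-∀
  expand y c D (suc n) with expand y c D n
  ... | E , e = (c ⊗ firstOrder y c n ⊕ y ⊗ E ⊕ scale D (c ⊗ E)) ,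
                trans (cong ((y ⊕ scale D c) ⊗_) e) (expandStep y c (y ^R n) (firstOrder y c n) E D)

  firstOrder-closed : ∀ y c n → firstOrder y c (suc n) ≡ scale (+ suc n) (c ⊗ y ^R n)
  firstOrder-closed (mk y1 y2) (mk c1 c2) zero = mk-cong (norm₁ y1 y2 c1 c2 A B) (norm₂ y1 y2 c1 c2 A B)
    where norm₁ : ∀ y1 y2 c1 c2 A B → y1 * + 0 - B * y2 * + 0 + (c1 * + 1 - B * c2 * + 0) ≡ (c1 * + 1 - B * c2 * + 0) * + 1
          norm₁ = solve-∀
          norm₂ : ∀ y1 y2 c1 c2 A B → y1 * + 0 + y2 * + 0 + A * y2 * + 0 + (c1 * + 0 + c2 * + 1 + A * c2 * + 0)
                 ≡ (c1 * + 0 + c2 * + 1 + A * c2 * + 0) * + 1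
          norm₂ = solve-∀
  firstOrder-closed y c (suc n) = trans (cong (λ t → y ⊗ t ⊕ c ⊗ (y ⊗ y ^R n)) (firstOrder-closed y c n)) (step y c (y ^R n) (+ suc n))
    where
      step : ∀ y c Y N → y ⊗ scale N (c ⊗ Y) ⊕ c ⊗ (y ⊗ Y) ≡ scale (+ 1 + N) (c ⊗ (y ⊗ Y))
      step (mk y1 y2) (mk c1 c2) (mk Y1 Y2) N = mk-cong (norm₁ y1 y2 c1 c2 Y1 Y2 N A B) (norm₂ y1 y2 c1 c2 Y1 Y2 N A B)
        where
          norm₁ : ∀ y1 y2 c1 c2 Y1 Y2 N A B →
               y1 * ((c1 * Y1 - B * c2 * Y2) * N) - B * y2 * ((c1 * Y2 + c2 * Y1 + A * c2 * Y2) * N)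
               + (c1 * (y1 * Y1 - B * y2 * Y2) - B * c2 * (y1 * Y2 + y2 * Y1 + A * y2 * Y2))
               ≡ (c1 * (y1 * Y1 - B * y2 * Y2) - B * c2 * (y1 * Y2 + y2 * Y1 + A * y2 * Y2)) * (+ 1 + N)
          norm₁ = solve-∀
          norm₂ : ∀ y1 y2 c1 c2 Y1 Y2 N A B →
               y1 * ((c1 * Y2 + c2 * Y1 + A * c2 * Y2) * N) + y2 * ((c1 * Y1 - B * c2 * Y2) * N)
                 + A * y2 * ((c1 * Y2 + c2 * Y1 + A * c2 * Y2) * N)
               + (c1 * (y1 * Y2 + y2 * Y1 + A * y2 * Y2) + c2 * (y1 * Y1 - B * y2 * Y2) + A * c2 * (y1 * Y2 + y2 * Y1 + A * y2 * Y2))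
               ≡ (c1 * (y1 * Y2 + y2 * Y1 + A * y2 * Y2) + c2 * (y1 * Y1 - B * y2 * Y2) + A * c2 * (y1 * Y2 + y2 * Y1 + A * y2 * Y2)) * (+ 1 + N)
          norm₂ = solve-∀

  -- With D = p d, the terms D·(p W) and D²·E are both multiples of p² d.
  collect : ∀ p d (X Y W E : ℤ[α]) → X ≡ Y ⊕ scale (+ (p ℕ.* d)) (scale (+ p) W) ⊕ scale (+ (p ℕ.* d) * + (p ℕ.* d)) E
             → X ≈R[ p ℕ.* (p ℕ.* d) ] Y
  collect p d (mk x1 x2) (mk y1 y2) (mk w1 w2) (mk e1 e2) eq =
    (w1 + e1 * + d , trans (cong re eq) (regroup y1 w1 e1)) & (w2 + e2 * + d , trans (cong im eq) (regroup y2 w2 e2))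
    where
      norm : ∀ Y W E P d → Y + W * P * (P * d) + E * ((P * d) * (P * d)) ≡ Y + (W + E * d) * (P * (P * d))
      norm = solve-∀
      generalised : ∀ Y W E P d D Q → D ≡ P * d → Q ≡ P * D → Y + W * P * D + E * (D * D) ≡ Y + (W + E * d) * Q
      generalised Y W E P d _ _ refl refl = norm Y W E P d
      regroup : ∀ Y W E → Y + W * + p * + (p ℕ.* d) + E * (+ (p ℕ.* d) * + (p ℕ.* d)) ≡ Y + (W + E * + d) * + (p ℕ.* (p ℕ.* d))
      regroup Y W E = generalised Y W E (+ p) (+ d) _ _ (pos-* p d) (pos-* p (p ℕ.* d))

  liftPower : ∀ p → 1 ℕ.≤ p → ∀ d x y → x ≈R[ p ℕ.* d ] y → x ^R p ≈R[ p ℕ.* (p ℕ.* d) ] y ^R p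
  liftPower (suc p') _ d x y ((k1 , e1) & (k2 , e2)) = conclude (expand y c D p)
    where
      p = suc p'
      D = + (p ℕ.* d)
      c = mk k1 k2
      conclude : Σ ℤ[α] (λ E → (y ⊕ scale D c) ^R p ≡ y ^R p ⊕ scale D (firstOrder y c p) ⊕ scale (D * D) E)
               → x ^R p ≈R[ p ℕ.* (p ℕ.* d) ] y ^R p
      conclude (E , e) = collect p d (x ^R p) (y ^R p) (c ⊗ y ^R p') E
        (trans (cong (_^R p) (mk-cong e1 e2))
          (trans e (cong (λ t → y ^R p ⊕ scale D t ⊕ scale (D * D) E) (firstOrder-closed y c p'))))

  liftPowerℤ : ∀ p → 1 ℕ.≤ p → ∀ d x y → x ≈[ p ℕ.* d ] y → x ^ p ≈[ p ℕ.* (p ℕ.* d) ] y ^ p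
  liftPowerℤ p p≥1 d x y e = subst₂ (_≈[ p ℕ.* (p ℕ.* d) ]_) (cong re (scalPow x p)) (cong re (scalPow y p))
    (cre (liftPower p p≥1 d (scal x) (scal y) (e & crefl)))

  liftPowerIter : ∀ p → 1 ℕ.≤ p → ∀ z w → z ≈R[ p ] w → ∀ k → z ^R (p ℕ.^ k) ≈R[ p ℕ.* p ℕ.^ k ] w ^R (p ℕ.^ k)
  liftPowerIter p p≥1 z w e zero = subst (λ m → z ^R 1 ≈R[ m ] w ^R 1) (sym (ℕP.*-identityʳ p))
    (rtrans (req (⊗-identityʳ z)) (rtrans e (req (sym (⊗-identityʳ w)))))
  liftPowerIter p p≥1 z w e (suc k) = rtrans (req (sym (^R-* z (p ℕ.^ k) p)))
    (rtrans (liftPower p p≥1 (p ℕ.^ k) (z ^R (p ℕ.^ k)) (w ^R (p ℕ.^ k)) (liftPowerIter p p≥1 z w e k))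
      (req (^R-* w (p ℕ.^ k) p)))

module LucasRelations (A B : Data.Integer.ℤ) where
  open import Data.Nat as ℕ using (zero; suc)
  open import Data.Integer as ℤ using (ℤ; +_; _+_; _-_; _*_; -_)
  open import Data.Integer.Tactic.RingSolver
  open import Relation.Binary.PropositionalEquality
  open import Defs using (lucasU; lucasV)

  u = lucasU A B
  v = lucasV A B

  v-via-u : ∀ n → v n ≡ + 2 * u (suc n) - A * u n
  v-via-u zero = norm A B
    where norm : ∀ A B → + 2 ≡ + 2 * + 1 - A * + 0
          norm = solve-∀
  v-via-u (suc zero) = norm A B
    where norm : ∀ A B → A ≡ + 2 * (A * + 1 - B * + 0) - A * + 1
          norm = solve-∀
  v-via-u (suc (suc n)) = trans (cong₂ (λ a b → A * a - B * b) (v-via-u (suc n)) (v-via-u n)) (norm (u n) (u (suc n)) A B)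
    where norm : ∀ a b A B → A * (+ 2 * (A * b - B * a) - A * b) - B * (+ 2 * b - A * a)
                  ≡ + 2 * (A * (A * b - B * a) - B * b) - A * (A * b - B * a)
          norm = solve-∀

  v-via-u′ : ∀ n → v (suc n) ≡ A * u (suc n) - + 2 * B * u n
  v-via-u′ n = trans (v-via-u (suc n)) (norm (u n) (u (suc n)) A B)
    where norm : ∀ a b A B → + 2 * (A * b - B * a) - A * b ≡ A * b - + 2 * B * a
          norm = solve-∀


module LucasInR (A B : Data.Integer.ℤ) where
  open import Data.Nat as ℕ using (ℕ; zero; suc)
  open import Data.Nat.Primality using (Prime)
  open import Data.Integer as ℤ using (ℤ; +_; _+_; _-_; _*_; -_; _^_)
  open import Data.Integer.Tactic.RingSolver
  open import Relation.Binary.PropositionalEquality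
  open Congruence
  open QuadraticRing A B
  open LucasRelations A B using (u; v)

  α : ℤ[α]
  α = mk (+ 0) (+ 1)

  α-power : ∀ n → α ^R suc n ≡ mk (- B * u n) (u (suc n))
  α-power zero = mk-cong (norm₁ B) (norm₂ A)
    where norm₁ : ∀ B → + 0 * + 1 - B * + 1 * + 0 ≡ - B * + 0
          norm₁ = solve-∀
          norm₂ : ∀ A → + 0 * + 0 + + 1 * + 1 + A * + 1 * + 0 ≡ + 1
          norm₂ = solve-∀
  α-power (suc n) = trans (cong (α ⊗_) (α-power n)) (mk-cong (norm₁ (u n) (u (suc n)) A B) (norm₂ (u n) (u (suc n)) A B))
    where norm₁ : ∀ a b A B → + 0 * (- B * a) - B * + 1 * b ≡ - B * b
          norm₁ = solve-∀
          norm₂ : ∀ a b A B → + 0 * b + + 1 * (- B * a) + A * + 1 * b ≡ A * b - B * a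
          norm₂ = solve-∀

  σ : ℤ[α] → ℤ[α]
  σ (mk x y) = mk (x + A * y) (- y)

  σ-⊗ : ∀ x y → σ (x ⊗ y) ≡ σ x ⊗ σ y
  σ-⊗ (mk a b) (mk c d) = mk-cong (norm₁ a b c d A B) (norm₂ a b c d A B)
    where norm₁ : ∀ a b c d A B → a * c - B * b * d + A * (a * d + b * c + A * b * d)
                  ≡ (a + A * b) * (c + A * d) - B * (- b) * (- d)
          norm₁ = solve-∀
          norm₂ : ∀ a b c d A B → - (a * d + b * c + A * b * d) ≡ (a + A * b) * (- d) + (- b) * (c + A * d) + A * (- b) * (- d)
          norm₂ = solve-∀

  σ-^ : ∀ x n → σ (x ^R n) ≡ σ x ^R n
  σ-^ x zero = mk-cong (norm A) refl
    where norm : ∀ A → + 1 + A * + 0 ≡ + 1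
          norm = solve-∀
  σ-^ x (suc n) = trans (σ-⊗ x (x ^R n)) (cong (σ x ⊗_) (σ-^ x n))

  -- The trace z + σ z (as an integer).
  tr : ℤ[α] → ℤ
  tr (mk x y) = + 2 * x + A * y

  tr-scal : ∀ z c → tr (z ⊗ scal c) ≡ c * tr z
  tr-scal (mk a b) c = norm a b c A B
    where norm : ∀ a b c A B → + 2 * (a * c - B * b * + 0) + A * (a * + 0 + b * c + A * b * + 0) ≡ c * (+ 2 * a + A * b)
          norm = solve-∀

  tr-product : ∀ z w → tr z * tr w ≡ tr (z ⊗ w) + tr (z ⊗ σ w)
  tr-product (mk a b) (mk c d) = norm a b c d A B
    where norm : ∀ a b c d A B → (+ 2 * a + A * b) * (+ 2 * c + A * d)
                ≡ + 2 * (a * c - B * b * d) + A * (a * d + b * c + A * b * d)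
                  + (+ 2 * (a * (c + A * d) - B * b * (- d)) + A * (a * (- d) + b * (c + A * d) + A * b * (- d)))
          norm = solve-∀

  tr-recurrence : ∀ z → tr (α ⊗ (α ⊗ z)) ≡ A * tr (α ⊗ z) - B * tr z
  tr-recurrence (mk a b) = norm a b A B
    where norm : ∀ a b A B → + 2 * (+ 0 * (+ 0 * a - B * + 1 * b) - B * + 1 * (+ 0 * b + + 1 * a + A * + 1 * b))
                 + A * (+ 0 * (+ 0 * b + + 1 * a + A * + 1 * b) + + 1 * (+ 0 * a - B * + 1 * b) + A * + 1 * (+ 0 * b + + 1 * a + A * + 1 * b))
                 ≡ A * (+ 2 * (+ 0 * a - B * + 1 * b) + A * (+ 0 * b + + 1 * a + A * + 1 * b)) - B * (+ 2 * a + A * b)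
          norm = solve-∀

  v≡tr : ∀ n → v n ≡ tr (α ^R n)
  v≡tr zero = norm A
    where norm : ∀ A → + 2 ≡ + 2 * + 1 + A * + 0
          norm = solve-∀
  v≡tr (suc zero) = norm A B
    where norm : ∀ A B → A ≡ + 2 * (+ 0 * + 1 - B * + 1 * + 0) + A * (+ 0 * + 0 + + 1 * + 1 + A * + 1 * + 0)
          norm = solve-∀
  v≡tr (suc (suc n)) = trans (cong₂ (λ a b → A * a - B * b) (v≡tr (suc n)) (v≡tr n)) (sym (tr-recurrence (α ^R n)))

  norm-α : α ⊗ σ α ≡ scal B
  norm-α = mk-cong (norm₁ A B) (norm₂ A B)
    where norm₁ : ∀ A B → + 0 * (+ 0 + A * + 1) - B * + 1 * (- + 1) ≡ B
          norm₁ = solve-∀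
          norm₂ : ∀ A B → + 0 * (- + 1) + + 1 * (+ 0 + A * + 1) + A * + 1 * (- + 1) ≡ + 0
          norm₂ = solve-∀

  norm-αᵐ : ∀ m → α ^R m ⊗ σ (α ^R m) ≡ scal (B ^ m)
  norm-αᵐ m = trans (cong (α ^R m ⊗_) (σ-^ α m)) (trans (sym (^R-⊗ α (σ α) m))
    (trans (cong (_^R m) norm-α) (scalPow B m)))

  v-composition : ∀ n m → v (n ℕ.+ m ℕ.+ m) ≡ v m * v (n ℕ.+ m) - B ^ m * v n
  v-composition n m = begin
    v (n ℕ.+ m ℕ.+ m) ≡⟨ v≡tr (n ℕ.+ m ℕ.+ m) ⟩
    tr (α ^R (n ℕ.+ m ℕ.+ m)) ≡⟨ cong tr (^R-+ α (n ℕ.+ m) m) ⟩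
    tr (αⁿ⁺ᵐ ⊗ αᵐ) ≡⟨ norm (tr (αⁿ⁺ᵐ ⊗ αᵐ)) (tr (αⁿ⁺ᵐ ⊗ σ αᵐ)) ⟩
    (tr (αⁿ⁺ᵐ ⊗ αᵐ) + tr (αⁿ⁺ᵐ ⊗ σ αᵐ)) - tr (αⁿ⁺ᵐ ⊗ σ αᵐ)
      ≡⟨ cong₂ _-_ (sym (tr-product αⁿ⁺ᵐ αᵐ)) (cong tr conjugate-part) ⟩
    tr αⁿ⁺ᵐ * tr αᵐ - tr (α ^R n ⊗ scal (B ^ m)) ≡⟨ cong₂ _-_ (commute (tr αⁿ⁺ᵐ) (tr αᵐ)) (tr-scal (α ^R n) (B ^ m)) ⟩
    tr αᵐ * tr αⁿ⁺ᵐ - B ^ m * tr (α ^R n) ≡⟨ sym (cong₂ (λ a b → a - B ^ m * b) (cong₂ _*_ (v≡tr m) (v≡tr (n ℕ.+ m))) (v≡tr n)) ⟩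
    v m * v (n ℕ.+ m) - B ^ m * v n ∎
    where
      open ≡-Reasoning
      αᵐ = α ^R m
      αⁿ⁺ᵐ = α ^R (n ℕ.+ m)
      conjugate-part : αⁿ⁺ᵐ ⊗ σ αᵐ ≡ α ^R n ⊗ scal (B ^ m)
      conjugate-part = trans (cong (_⊗ σ αᵐ) (^R-+ α n m))
        (trans (⊗-assoc (α ^R n) αᵐ (σ αᵐ)) (cong (α ^R n ⊗_) (norm-αᵐ m)))
      norm : ∀ a b → a ≡ (a + b) - b
      norm = solve-∀
      commute : ∀ a b → a * b ≡ b * a
      commute = solve-∀

  Δ : ℤ
  Δ = A ^ 2 - + 4 * B

  -- √Δ = 2α − A, so that A + √Δ = 2α and √Δ² = Δ.
  √Δ : ℤ[α]
  √Δ = mk (- A) (+ 2)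

  A+√Δ : scal A ⊕ √Δ ≡ scal (+ 2) ⊗ α
  A+√Δ = mk-cong (norm₁ A B) (norm₂ A)
    where norm₁ : ∀ A B → A + - A ≡ + 2 * + 0 - B * + 0 * + 1
          norm₁ = solve-∀
          norm₂ : ∀ A → + 0 + + 2 ≡ + 2 * + 1 + + 0 * + 0 + A * + 0 * + 1
          norm₂ = solve-∀

  √Δ² : √Δ ⊗ √Δ ≡ scal Δ
  √Δ² = mk-cong (norm₁ A B) (norm₂ A B)
    where norm₁ : ∀ A B → - A * - A - B * + 2 * + 2 ≡ A * (A * + 1) - + 4 * B
          norm₁ = solve-∀
          norm₂ : ∀ A B → - A * + 2 + + 2 * - A + A * + 2 * + 2 ≡ + 0
          norm₂ = solve-∀

  √Δ-odd-power : ∀ h → √Δ ^R suc (h ℕ.+ h) ≡ √Δ ⊗ scal (Δ ^ h)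
  √Δ-odd-power h = cong (√Δ ⊗_) (trans (^R-+ √Δ h h) (trans (sym (^R-⊗ √Δ √Δ h)) (trans (cong (_^R h) √Δ²) (scalPow Δ h))))

  -- Frobenius applied to 2α = A + √Δ, for p = 2h + 1:
  -- 2^p α^p ≡ A^p + Δ^h √Δ (mod p), read coordinatewise.
  module FrobeniusOfα (h : ℕ) (pp : Prime (suc (h ℕ.+ h))) where
    private
      p = suc (h ℕ.+ h)
      frobenius2α : scal ((+ 2) ^ p) ⊗ mk (- B * u (h ℕ.+ h)) (u p) ≈R[ p ] scal (A ^ p) ⊕ √Δ ⊗ scal (Δ ^ h)
      frobenius2α = rtrans (req lhs) (rtrans (frobeniusR p pp (scal A) √Δ) (req rhs))
        where
          lhs : scal ((+ 2) ^ p) ⊗ mk (- B * u (h ℕ.+ h)) (u p) ≡ (scal A ⊕ √Δ) ^R p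
          lhs = sym (trans (cong (_^R p) A+√Δ) (trans (^R-⊗ (scal (+ 2)) α p)
                  (trans (cong (_⊗ (α ^R p)) (scalPow (+ 2) p)) (cong (scal ((+ 2) ^ p) ⊗_) (α-power (h ℕ.+ h))))))
          rhs : scal A ^R p ⊕ √Δ ^R p ≡ scal (A ^ p) ⊕ √Δ ⊗ scal (Δ ^ h)
          rhs = trans (cong (_⊕ (√Δ ^R p)) (scalPow A p)) (cong (scal (A ^ p) ⊕_) (√Δ-odd-power h))

    frobenius-re : (+ 2) ^ p * (- B * u (h ℕ.+ h)) ≈[ p ] A ^ p - A * Δ ^ h
    frobenius-re = ctrans (ceq (norm₁ ((+ 2) ^ p) (- B * u (h ℕ.+ h)) (u p) B)) (ctrans (cre frobenius2α) (ceq (norm₂ (A ^ p) A (Δ ^ h) B)))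
      where norm₁ : ∀ c a b B → c * a ≡ c * a - B * + 0 * b
            norm₁ = solve-∀
            norm₂ : ∀ X A D B → X + (- A * D - B * + 2 * + 0) ≡ X - A * D
            norm₂ = solve-∀

    frobenius-im : (+ 2) ^ p * u p ≈[ p ] + 2 * Δ ^ h
    frobenius-im = ctrans (ceq (norm₁ ((+ 2) ^ p) (- B * u (h ℕ.+ h)) (u p) A)) (ctrans (cim frobenius2α) (ceq (norm₂ A (Δ ^ h))))
      where norm₁ : ∀ c a b A → c * b ≡ c * b + + 0 * a + A * + 0 * b
            norm₁ = solve-∀
            norm₂ : ∀ A D → + 0 + (- A * + 0 + + 2 * D + A * + 2 * + 0) ≡ + 2 * D
            norm₂ = solve-∀

-- In the
-- inert case α^N ≡ σ(α^M) gives −B u_(N−1) ≡ −B u_(M−1) + A u_M and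
-- u_N ≡ −u_M; the recurrences then relate the indices N + 1, M − 1 and
-- N − 1, M + 1.
module IndexShift (A B : Data.Integer.ℤ) {q : Data.Nat.ℕ} where
  open import Data.Nat as ℕ using (ℕ; suc)
  open import Data.Integer as ℤ using (ℤ; +_; _+_; _-_; _*_; -_)
  open import Data.Integer.Tactic.RingSolver
  open import Relation.Binary.PropositionalEquality
  open Congruence
  open LucasRelations A B

  module Inert (N' M' : ℕ) (re≈ : - B * u N' ≈[ q ] - B * u M' + A * u (suc M'))
               (im≈ : u (suc N') ≈[ q ] - u (suc M')) where

    u-after : u (suc (suc N')) ≈[ q ] B * (- (+ 1) * u M')
    u-after = ctrans (ceq (norm₁ (u N') (u (suc N')) A B)) (ctrans (c+ (c*l A im≈) re≈) (ceq (norm₂ (u M') (u (suc M')) A B)))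
      where norm₁ : ∀ a b A B → A * b - B * a ≡ A * b + - B * a
            norm₁ = solve-∀
            norm₂ : ∀ a b A B → A * (- b) + (- B * a + A * b) ≡ B * (- (+ 1) * a)
            norm₂ = solve-∀

    v-after : v (suc (suc N')) ≈[ q ] B * v M'
    v-after = ctrans (ceq (v-via-u′ (suc N')))
      (ctrans (c- (c*l A u-after) (c*l (+ 2 * B) im≈))
        (ceq (trans (norm (u M') (u (suc M')) A B) (cong (B *_) (sym (v-via-u M'))))))
      where norm : ∀ a b A B → A * (B * (- (+ 1) * a)) - + 2 * B * (- b) ≡ B * (+ 2 * b - A * a)
            norm = solve-∀

    u-before : B * u N' ≈[ q ] - (+ 1) * u (suc (suc M'))
    u-before = ctrans (ceq (norm₁ (u N') B)) (ctrans (cneg re≈) (ceq (norm₂ (u M') (u (suc M')) A B)))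
      where norm₁ : ∀ a B → B * a ≡ - (- B * a)
            norm₁ = solve-∀
            norm₂ : ∀ a b A B → - (- B * a + A * b) ≡ - (+ 1) * (A * b - B * a)
            norm₂ = solve-∀

    v-before : B * v N' ≈[ q ] v (suc (suc M'))
    v-before = ctrans (ceq (trans (cong (B *_) (v-via-u N')) (norm₁ (u N') (u (suc N')) A B)))
      (ctrans (c+ (c*l (+ 2 * B) im≈) (c*l A re≈))
        (ceq (trans (norm₂ (u M') (u (suc M')) A B) (sym (v-via-u′ (suc M'))))))
      where norm₁ : ∀ a b A B → B * (+ 2 * b - A * a) ≡ + 2 * B * b + A * (- B * a)
            norm₁ = solve-∀
            norm₂ : ∀ a b A B → + 2 * B * (- b) + A * (- B * a + A * b) ≡ A * (A * b - B * a) - + 2 * B * b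
            norm₂ = solve-∀

  v-from-u : ∀ N' M' → u N' ≈[ q ] u M' → u (suc N') ≈[ q ] u (suc M') → v N' ≈[ q ] v M'
  v-from-u N' M' e₀ e₁ = ctrans (ceq (v-via-u N')) (ctrans (c- (c*l (+ 2) e₁) (c*l A e₀)) (ceq (sym (v-via-u M'))))

module OddPrime (A B : Data.Integer.ℤ) (h : Data.Nat.ℕ) (pp : Data.Nat.Primality.Prime (Data.Nat.suc (h Data.Nat.+ h))) where
  open import Data.Nat as ℕ using (ℕ; zero; suc)
  import Data.Nat.Properties as ℕP
  open import Data.Integer as ℤ using (ℤ; +_; _+_; _-_; _*_; -_; _^_)
  open import Data.Integer.Tactic.RingSolver
  open import Data.Product using (_,_; _×_; proj₁; proj₂)
  open import Data.Sum using (inj₁; inj₂)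
  open import Relation.Nullary using (¬_)
  open import Relation.Binary.PropositionalEquality
  open import Defs using (legendre)
  open Congruence
  open Fermat using (fermat)
  open Euler using (eulerCriterion; legendre-cases)
  open IndexShift A B using (v-from-u)
  open QuadraticRing A B
  open LucasRelations A B
  open LucasInR A B

  p = suc (h ℕ.+ h)
  open ModPrime p pp public
  open FrobeniusOfα h pp

  ε = legendre p Δ

  euler : Δ ^ h ≈[ p ] ε
  euler = eulerCriterion p pp h refl Δ

  cancel2 : ∀ x y → + 2 * x ≈[ p ] + 2 * y → x ≈[ p ] y
  cancel2 x y = cancelModP (+ 2) x y (nat≉0 2 (ℕ.s≤s ℕ.z≤n) (ℕ.s≤s (ℕP.+-mono-≤ h≥1 h≥1)))
    where open Euler.Criterion p pp h refl using (h≥1)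

  -- The two coordinates of 2^p α^p ≡ A^p + Δ^h √Δ, simplified by Fermat and Euler.
  twice-re : + 2 * (- B * u (h ℕ.+ h)) ≈[ p ] A - A * ε
  twice-re = ctrans (c* (csym (fermat p pp (+ 2))) crefl) (ctrans frobenius-re (c- (fermat p pp A) (c*l A euler)))

  twice-im : + 2 * u p ≈[ p ] + 2 * ε
  twice-im = ctrans (c* (csym (fermat p pp (+ 2))) crefl) (ctrans frobenius-im (c*l (+ 2) euler))

  u-prime : u p ≈[ p ] ε
  u-prime = cancel2 _ _ twice-im

  -- α^p ≡ α, σα or A/2 = A(h+1) (mod p) according as ε = 1, −1, 0.
  α^p-split : ε ≡ + 1 → α ^R p ≈R[ p ] α
  α^p-split e = rtrans (req (α-power (h ℕ.+ h)))
      (cancel2 _ _ (ctrans twice-re (ceq (trans (cong (λ t → A - A * t) e) (norm A))))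
      & ctrans u-prime (ceq e))
    where norm : ∀ A → A - A * + 1 ≡ + 2 * + 0
          norm = solve-∀

  α^p-inert : ε ≡ - (+ 1) → α ^R p ≈R[ p ] σ α
  α^p-inert e = rtrans (req (α-power (h ℕ.+ h)))
      (cancel2 _ _ (ctrans twice-re (ceq (trans (cong (λ t → A - A * t) e) (norm A))))
      & ctrans u-prime (ceq e))
    where norm : ∀ A → A - A * - (+ 1) ≡ + 2 * (+ 0 + A * + 1)
          norm = solve-∀

  α^p-ramified : ε ≡ + 0 → α ^R p ≈R[ p ] scal (A * + suc h)
  α^p-ramified e = rtrans (req (α-power (h ℕ.+ h)))
      (cancel2 _ _ (ctrans twice-re (subst (λ t → A - A * t ≈[ p ] + 2 * (A * + suc h)) (sym e) (- A , norm A (+ h))))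
      & ctrans u-prime (ceq e))
    where norm : ∀ A H → A - A * + 0 ≡ + 2 * (A * (+ 1 + H)) + (- A) * (+ 1 + (H + H))
          norm = solve-∀

  liftα : ∀ γ → α ^R p ≈R[ p ] γ → ∀ k → α ^R (p ℕ.^ suc k) ≈R[ p ℕ.^ suc k ] γ ^R (p ℕ.^ k)
  liftα γ e k = rtrans (req (trans (cong (α ^R_) (ℕP.*-comm p (p ℕ.^ k))) (sym (^R-* α p (p ℕ.^ k)))))
                  (liftPowerIter p p≥1 (α ^R p) γ e k)

  α-power′ : ∀ N → 1 ℕ.≤ N → α ^R N ≡ mk (- B * u (N ℕ.∸ 1)) (u N)
  α-power′ (suc n) _ = α-power n

  suc-∸1 : ∀ n → 1 ℕ.≤ n → suc (n ℕ.∸ 1) ≡ n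
  suc-∸1 (suc n) _ = refl

  module Level (k : ℕ) where
    N = p ℕ.^ suc k
    M = p ℕ.^ k
    N' = N ℕ.∸ 1
    M' = M ℕ.∸ 1

    sN : suc N' ≡ N
    sN = suc-∸1 N (pow≥1 (suc k))
    sM : suc M' ≡ M
    sM = suc-∸1 M (pow≥1 k)

    α^N : α ^R N ≡ mk (- B * u N') (u N)
    α^N = α-power′ N (pow≥1 (suc k))

    α^M : α ^R M ≡ mk (- B * u M') (u M)
    α^M = α-power′ M (pow≥1 k)

    split : ε ≡ + 1 → (- B * u N' ≈[ N ] - B * u M') × (u N ≈[ N ] u M)
    split e = cre r , cim r
      where r = rtrans (req (sym α^N)) (rtrans (liftα α (α^p-split e) k) (req α^M))

    inert : ε ≡ - (+ 1) → (- B * u N' ≈[ N ] - B * u M' + A * u M) × (u N ≈[ N ] - u M)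
    inert e = cre r , cim r
      where r = rtrans (req (sym α^N)) (rtrans (liftα (σ α) (α^p-inert e) k) (req (trans (sym (σ-^ α M)) (cong σ α^M))))

    ramified : ε ≡ + 0 → u N ≈[ N ] + 0
    ramified e = cim (rtrans (req (sym α^N)) (rtrans (liftα (scal (A * + suc h)) (α^p-ramified e) k) (req (scalPow _ M))))

    u-prime-power : u N ≈[ N ] ε * u M
    u-prime-power with legendre-cases p Δ
    ... | inj₁ e = ctrans (ramified e) (ceq (trans (norm (u M)) (cong (_* u M) (sym e))))
      where norm : ∀ a → + 0 ≡ + 0 * a
            norm = solve-∀
    ... | inj₂ (inj₁ e) = ctrans (proj₂ (split e)) (ceq (trans (norm (u M)) (cong (_* u M) (sym e))))
      where norm : ∀ a → a ≡ + 1 * a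
            norm = solve-∀
    ... | inj₂ (inj₂ e) = ctrans (proj₂ (inert e)) (ceq (trans (norm (u M)) (cong (_* u M) (sym e))))
      where norm : ∀ a → - a ≡ - (+ 1) * a
            norm = solve-∀

    split-u : ε ≡ + 1 → ¬ (B ≈[ p ] + 0) → u N' ≈[ N ] u M'
    split-u e nb = cancel (suc k) (- B) (u N') (u M') (λ z → nb (subst (_≈[ p ] + 0) (norm B) (cneg z)))
                     (proj₁ (split e))
      where norm : ∀ B → - - B ≡ B
            norm = solve-∀

    split-v : ε ≡ + 1 → ¬ (B ≈[ p ] + 0) → v N' ≈[ N ] v M'
    split-v e nb = v-from-u N' M' (split-u e nb)
      (subst₂ (λ a b → u a ≈[ N ] u b) (sym sN) (sym sM) (proj₂ (split e)))

    module Inert (e : ε ≡ - (+ 1)) where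
      open IndexShift.Inert A B N' M'
        (subst (λ t → - B * u N' ≈[ N ] - B * u M' + A * u t) (sym sM) (proj₁ (inert e)))
        (subst₂ (λ a b → u a ≈[ N ] - u b) (sym sN) (sym sM) (proj₂ (inert e)))

      u-after′ : u (suc N) ≈[ N ] B * (- (+ 1) * u M')
      u-after′ = subst (λ t → u (suc t) ≈[ N ] B * (- (+ 1) * u M')) sN u-after
      v-after′ : v (suc N) ≈[ N ] B * v M'
      v-after′ = subst (λ t → v (suc t) ≈[ N ] B * v M') sN v-after
      u-before′ : B * u N' ≈[ N ] - (+ 1) * u (suc M)
      u-before′ = subst (λ t → B * u N' ≈[ N ] - (+ 1) * u (suc t)) sM u-before
      v-before′ : B * v N' ≈[ N ] v (suc M)
      v-before′ = subst (λ t → B * v N' ≈[ N ] v (suc t)) sM v-before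

  module Descent (nb : ¬ (B ≈[ p ] + 0)) where
    cancelB : ∀ {x y} → B * x ≈[ p ] B * y → x ≈[ p ] y
    cancelB {x} {y} = cancelModP B x y nb

    p¹≡p : p ℕ.^ 1 ≡ p
    p¹≡p = ℕP.*-identityʳ p

    split-descent : ε ≡ + 1 → ∀ k → let N' = p ℕ.^ suc k ℕ.∸ 1 in
          (u N' ≈[ p ℕ.^ 2 ] u (p ℕ.∸ 1)) × (u N' ≈[ p ] + 0) × (v N' ≈[ p ℕ.^ 2 ] v (p ℕ.∸ 1)) × (v N' ≈[ p ] + 2)
    split-descent e zero = subst (λ t → u (t ℕ.∸ 1) ≈[ p ℕ.^ 2 ] u (p ℕ.∸ 1)) (sym p¹≡p) crefl
               , weak1 0 (Level.split-u 0 e nb)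
               , subst (λ t → v (t ℕ.∸ 1) ≈[ p ℕ.^ 2 ] v (p ℕ.∸ 1)) (sym p¹≡p) crefl
               , weak1 0 (Level.split-v 0 e nb)
    split-descent e (suc k) with split-descent e k
    ... | u₂ , u₁ , v₂ , v₁ = ctrans (weak2 k (Level.split-u (suc k) e nb)) u₂
                            , ctrans (weak1 (suc k) (Level.split-u (suc k) e nb)) u₁
                            , ctrans (weak2 k (Level.split-v (suc k) e nb)) v₂
                            , ctrans (weak1 (suc k) (Level.split-v (suc k) e nb)) v₁

    InertEven : ℕ → Set
    InertEven k = (u (suc (p ℕ.^ suc k)) ≈[ p ℕ.^ 2 ] u (suc p)) × (u (suc (p ℕ.^ suc k)) ≈[ p ] + 0)
                × (v (suc (p ℕ.^ suc k)) ≈[ p ℕ.^ 2 ] v (suc p)) × (v (suc (p ℕ.^ suc k)) ≈[ p ] B * + 2)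

    InertOdd : ℕ → Set
    InertOdd k = (B * u (p ℕ.^ suc k ℕ.∸ 1) ≈[ p ℕ.^ 2 ] - (+ 1) * u (suc p)) × (u (p ℕ.^ suc k ℕ.∸ 1) ≈[ p ] + 0)
               × (B * v (p ℕ.^ suc k ℕ.∸ 1) ≈[ p ℕ.^ 2 ] v (suc p)) × (v (p ℕ.^ suc k ℕ.∸ 1) ≈[ p ] + 2)

    module _ (e : ε ≡ - (+ 1)) where
      inert-even : ∀ j → InertEven (j ℕ.+ j)
      inert-odd : ∀ j → InertOdd (suc (j ℕ.+ j))

      inert-even zero = subst (λ t → u (suc t) ≈[ p ℕ.^ 2 ] u (suc p)) (sym p¹≡p) crefl
               , ctrans (weak1 0 (Level.Inert.u-after′ 0 e)) (ceq (norm B))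
               , subst (λ t → v (suc t) ≈[ p ℕ.^ 2 ] v (suc p)) (sym p¹≡p) crefl
               , weak1 0 (Level.Inert.v-after′ 0 e)
        where norm : ∀ B → B * (- (+ 1) * + 0) ≡ + 0
              norm = solve-∀
      inert-even (suc j) = subst InertEven (cong suc (sym (ℕP.+-suc j j))) (step (inert-odd j))
        where
          K = suc (suc (j ℕ.+ j))
          open Level.Inert K e
          norm₁ : ∀ B a → B * (- (+ 1) * a) ≡ - (+ 1) * (B * a)
          norm₁ = solve-∀
          norm₂ : ∀ b → - (+ 1) * (- (+ 1) * b) ≡ b
          norm₂ = solve-∀
          norm₃ : ∀ B → B * (- (+ 1) * + 0) ≡ + 0
          norm₃ = solve-∀
          step : InertOdd (suc (j ℕ.+ j)) → InertEven K
          step (u₂ , u₁ , v₂ , v₁) =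
                 ctrans (weak2 (suc (j ℕ.+ j)) u-after′)
                   (ctrans (ceq (norm₁ B _)) (ctrans (c*l (- (+ 1)) u₂) (ceq (norm₂ _))))
               , ctrans (weak1 K u-after′) (ctrans (c*l B (c*l (- (+ 1)) u₁)) (ceq (norm₃ B)))
               , ctrans (weak2 (suc (j ℕ.+ j)) v-after′) v₂
               , ctrans (weak1 K v-after′) (c*l B v₁)

      inert-odd j = step (inert-even j)
        where
          k = suc (j ℕ.+ j)
          open Level.Inert k e
          norm : ∀ B → - (+ 1) * + 0 ≡ B * + 0
          norm = solve-∀
          step : InertEven (j ℕ.+ j) → InertOdd k
          step (u₂ , u₁ , v₂ , v₁) =
                   ctrans (weak2 (j ℕ.+ j) u-before′) (c*l (- (+ 1)) u₂)
                 , cancelB (ctrans (weak1 k u-before′) (ctrans (c*l (- (+ 1)) u₁) (ceq (norm B))))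
                 , ctrans (weak2 (j ℕ.+ j) v-before′) v₂
                 , cancelB (ctrans (weak1 k v-before′) v₁)

module VSequence where
  open import Data.Nat as ℕ using (ℕ; zero; suc)
  import Data.Nat.Properties as ℕP
  import Data.Nat.Divisibility as ℕD
  open import Data.Nat.Primality using (Prime; prime⇒irreducible)
  open import Data.Integer as ℤ using (ℤ; +_; _+_; _-_; _*_; -_; _^_)
  open import Data.Integer.Properties using (pos-*; ^-*-assoc)
  open import Data.Integer.Tactic.RingSolver
  open import Data.Product using (Σ; _,_; _×_)
  open import Data.Sum using (_⊎_; inj₁; inj₂)
  open import Relation.Binary.PropositionalEquality
  open import Defs using (lucasU; lucasV)
  open Congruence
  open Fermat using (fermat)

  -- First-order Taylor expansion of V_n in its parameters: for
  -- (x', y') = (x + sD, y + tD), V_n(x', y') = V_n(x, y) + D·E_n + D²·K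
  -- with E_n = n (s U_n − t U_(n−1)).
  module Taylor (x y s t D : ℤ) where
    U = lucasU x y
    V = lucasV x y
    V' = lucasV (x + s * D) (y + t * D)
    E : ℕ → ℤ
    E n = + n * (s * U n - t * U (n ℕ.∸ 1))
    open LucasRelations x y using (v-via-u′)

    E-recurrence : ∀ n → E (suc (suc n)) ≡ x * E (suc n) + s * V (suc n) - y * E n - t * V n
    E-recurrence zero = norm x y s t
      where norm : ∀ x y s t → + 2 * (s * (x * + 1 - y * + 0) - t * + 1)
                  ≡ x * (+ 1 * (s * + 1 - t * + 0)) + s * x - y * (+ 0 * (s * + 0 - t * + 0)) - t * + 2
            norm = solve-∀
    E-recurrence (suc m) = trans (norm x y s t (+ m) (U m) (U (suc m)))
                     (sym (cong₂ (λ a b → x * E (suc (suc m)) + s * a - y * E (suc m) - t * b) (v-via-u′ (suc m)) (v-via-u′ m)))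
      where norm : ∀ x y s t N a b →
                (+ 3 + N) * (s * (x * (x * b - y * a) - y * b) - t * (x * b - y * a))
                ≡ x * ((+ 2 + N) * (s * (x * b - y * a) - t * b)) + s * (x * (x * b - y * a) - + 2 * y * b)
                  - y * ((+ 1 + N) * (s * b - t * a)) - t * (x * b - + 2 * y * a)
            norm = solve-∀

    Expansion : ℕ → Set
    Expansion n = Σ ℤ λ K → V' n ≡ V n + E n * D + K * (D * D)

    expansion : ∀ n → Expansion n × Expansion (suc n)
    expansion zero = (+ 0 , norm₀ s t D) , (+ 0 , norm₁ x s t D)
      where norm₀ : ∀ s t D → + 2 ≡ + 2 + + 0 * (s * + 0 - t * + 0) * D + + 0 * (D * D)
            norm₀ = solve-∀
            norm₁ : ∀ x s t D → x + s * D ≡ x + + 1 * (s * + 1 - t * + 0) * D + + 0 * (D * D)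
            norm₁ = solve-∀
    expansion (suc n) with expansion n
    ... | (K₀ , e₀) , (K₁ , e₁) = (K₁ , e₁) ,
          (K , trans (cong₂ (λ a b → (x + s * D) * a - (y + t * D) * b) e₁ e₀)
             (trans (norm x y s t D (V n) (V (suc n)) (E n) (E (suc n)) K₀ K₁)
               (cong (λ z → x * V (suc n) - y * V n + z * D + K * (D * D)) (sym (E-recurrence n)))))
      where K = x * K₁ + s * E (suc n) + s * D * K₁ - y * K₀ - t * E n - t * D * K₀
            norm : ∀ x y s t D V0 V1 E0 E1 K0 K1 →
                (x + s * D) * (V1 + E1 * D + K1 * (D * D)) - (y + t * D) * (V0 + E0 * D + K0 * (D * D))
                ≡ x * V1 - y * V0 + (x * E1 + s * V1 - y * E0 - t * V0) * D
                  + (x * K1 + s * E1 + s * D * K1 - y * K0 - t * E0 - t * D * K0) * (D * D)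
            norm = solve-∀

  taylor : ∀ p d x y x' y' → x ≈[ p ℕ.* d ] x' → y ≈[ p ℕ.* d ] y' → lucasV x y p ≈[ p ℕ.* (p ℕ.* d) ] lucasV x' y' p
  taylor p d x y x' y' (s , refl) (t , refl) with Taylor.expansion x' y' s t (+ (p ℕ.* d)) p
  ... | (K , e) , _ = W + K * + d , trans e (regroup (lucasV x' y' p) W K (+ p) (+ d) _ _ (pos-* p d) (pos-* p (p ℕ.* d)))
    where
      W = s * lucasU x' y' p - t * lucasU x' y' (p ℕ.∸ 1)
      norm : ∀ V W K P d → V + P * W * (P * d) + K * ((P * d) * (P * d)) ≡ V + (W + K * d) * (P * (P * d))
      norm = solve-∀
      regroup : ∀ V W K P d D Q → D ≡ P * d → Q ≡ P * D → V + P * W * D + K * (D * D) ≡ V + (W + K * d) * Q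
      regroup V W K P d _ _ refl refl = norm V W K P d

  composition : ∀ A B m k → lucasV A B (k ℕ.* m) ≡ lucasV (lucasV A B m) (B ^ m) k
  composition A B m zero = refl
  composition A B m (suc zero) = cong (lucasV A B) (ℕP.+-identityʳ m)
  composition A B m (suc (suc k)) = trans (cong v (reindex m k)) (trans (v-composition (k ℕ.* m) m)
      (cong₂ (λ a b → v m * a - B ^ m * b) (trans (cong v (ℕP.+-comm (k ℕ.* m) m)) (composition A B m (suc k)))
        (composition A B m k)))
    where
      open LucasInR A B using (v-composition)
      v = lucasV A B
      reindex : ∀ m k → m ℕ.+ (m ℕ.+ k ℕ.* m) ≡ k ℕ.* m ℕ.+ m ℕ.+ m
      reindex m k = ℕnorm m (k ℕ.* m)
        where import Data.Nat.Tactic.RingSolver as ℕRing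
              ℕnorm : ∀ m n → m ℕ.+ (m ℕ.+ n) ≡ n ℕ.+ m ℕ.+ m
              ℕnorm = ℕRing.solve-∀

  data Odd : ℕ → Set where
    odd : ∀ h → Odd (suc (h ℕ.+ h))

  data Parity : ℕ → Set where
    even : ∀ h → Parity (h ℕ.+ h)
    odd : ∀ h → Parity (suc (h ℕ.+ h))

  parity : ∀ n → Parity n
  parity zero = even 0
  parity (suc n) with parity n
  ... | even h = odd h
  ... | odd h = subst Parity (cong suc (ℕP.+-suc h h)) (even (suc h))

  two-or-odd : ∀ p → Prime p → p ≡ 2 ⊎ Odd p
  two-or-odd p pp with parity p
  ... | odd h = inj₂ (odd h)
  ... | even h with prime⇒irreducible pp (ℕD.divides h (trans (cong (h ℕ.+_) (sym (ℕP.+-identityʳ h))) (ℕP.*-comm 2 h)))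
  ...   | inj₁ ()
  ...   | inj₂ e = inj₁ (sym e)

  -- v_p ≡ A (mod p): for p = 2 since v_2 = A² − 2B, for odd p by Frobenius.
  v-prime : ∀ A B p → Prime p → lucasV A B p ≈[ p ] A
  v-prime A B p pp with two-or-odd p pp
  ... | inj₁ refl = ctrans (- B , norm A B) (fermat 2 pp A)
    where norm : ∀ A B → A * A - B * + 2 ≡ A * (A * + 1) + - B * + 2
          norm = solve-∀
  v-prime A B .(suc (h ℕ.+ h)) pp | inj₂ (odd h) =
    ctrans (ceq (trans (v-via-u′ (h ℕ.+ h)) (norm₁ A B (u (h ℕ.+ h)) (u (suc (h ℕ.+ h))))))
      (ctrans (c+ (c*l A u-prime) twice-re) (ceq (norm₂ A ε)))
    where
      open OddPrime A B h pp using (u-prime; twice-re; ε)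
      open LucasRelations A B using (v-via-u′; u)
      norm₁ : ∀ A B a b → A * b - + 2 * B * a ≡ A * b + + 2 * (- B * a)
      norm₁ = solve-∀
      norm₂ : ∀ A e → A * e + (A - A * e) ≡ A
      norm₂ = solve-∀

  -- Induction on k, lifting both v_(p^k) and B^(p^k) together.
  v-prime-power : ∀ A B p → Prime p → ∀ k →
    (lucasV A B (p ℕ.^ suc k) ≈[ p ℕ.^ suc k ] lucasV A B (p ℕ.^ k)) × (B ^ (p ℕ.^ suc k) ≈[ p ℕ.^ suc k ] B ^ (p ℕ.^ k))
  v-prime-power A B p pp zero =
      mod1 p (subst (λ t → lucasV A B t ≈[ p ] A) (sym (ℕP.*-identityʳ p)) (v-prime A B p pp))
    , mod1 p (subst (λ t → B ^ t ≈[ p ] B ^ 1) (sym (ℕP.*-identityʳ p)) (ctrans (fermat p pp B) (ceq (norm B))))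
    where norm : ∀ B → B ≡ B * + 1
          norm = solve-∀
  v-prime-power A B p pp (suc k) with v-prime-power A B p pp k
  ... | v≈ , B≈ =
      subst₂ (_≈[ p ℕ.^ suc (suc k) ]_) (sym (composition A B (p ℕ.^ suc k) p)) (sym (composition A B (p ℕ.^ k) p))
        (taylor p (p ℕ.^ k) _ _ _ _ v≈ B≈)
    , subst₂ (_≈[ p ℕ.^ suc (suc k) ]_) (power (p ℕ.^ suc k)) (power (p ℕ.^ k))
        (QuadraticRing.liftPowerℤ A B p (ModPrime.p≥1 p pp) (p ℕ.^ k) _ _ B≈)
    where power : ∀ m → (B ^ m) ^ p ≡ B ^ (p ℕ.* m)
          power m = trans (^-*-assoc B m p) (cong (B ^_) (ℕP.*-comm m p))

module Assembly where
  open import Defs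
  open import Data.Nat as ℕ using (ℕ; suc; _∸_; _≤_)
  import Data.Nat.Properties as ℕP
  open import Data.Nat.Primality using (Prime)
  open import Data.Integer as ℤ using (ℤ; +_; _+_; _-_; _*_; ∣_∣; -_)
  open import Data.Integer.Properties using (^-zeroˡ; ^-distribˡ-+-*)
  open import Data.Integer.Divisibility using (_∣_)
  open import Data.Integer.DivMod using (_/_)
  open import Data.Integer.Tactic.RingSolver
  open import Data.Product using (_×_; _,_; proj₁)
  open import Data.Sum using (inj₁; inj₂)
  open import Data.Empty using (⊥-elim)
  open import Relation.Nullary using (¬_)
  open import Relation.Binary.PropositionalEquality
  open Congruence
  open Euler using (legendre-unit; ^-distribʳ-*)
  open VSequence

  Conclusions : (p k : ℕ) (A B L εa εa₁ ε₁ : ℤ) (n n₁ m : ℕ) → Set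
  Conclusions p k A B L εa εa₁ ε₁ n n₁ m =
    congBPow q B ((εa₁ - εa) / (+ 2)) (u n) (L * u n₁)
    × congBPow (p ℕ.^ 2) B ((ε₁ - εa) / (+ 2)) (u n) (εa₁ * u m)
    × (u n ≡ + 0 [mod p ])
    × congBPow q B ((εa₁ - εa) / (+ 2)) (v n) (v n₁)
    × congBPow (p ℕ.^ 2) B ((ε₁ - εa) / (+ 2)) (v n) (v m)
    × congBPow p B ((+ 1 - εa) / (+ 2)) (v n) (+ 2)
    where q = p ℕ.^ suc k
          u = lucasU A B
          v = lucasV A B

  transport : ∀ {p k A B L L' a a' b b' c c' n n' n₁ n₁' m m'} → L ≡ L' → a ≡ a' → b ≡ b' → c ≡ c'
    → n ≡ n' → n₁ ≡ n₁' → m ≡ m' → Conclusions p k A B L' a' b' c' n' n₁' m' → Conclusions p k A B L a b c n n₁ m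
  transport refl refl refl refl refl refl refl g = g

  ∣N-1∣ : ∀ N → 1 ≤ N → ∣ + N - + 1 ∣ ≡ N ∸ 1
  ∣N-1∣ (suc n) _ = refl

  ∣N+1∣ : ∀ N → ∣ + N - - (+ 1) ∣ ≡ suc N
  ∣N+1∣ N = ℕP.+-comm N 1

  -1^even : ∀ j → (- (+ 1)) ℤ.^ (j ℕ.+ j) ≡ + 1
  -1^even j = trans (^-distribˡ-+-* (- (+ 1)) j j) (trans (sym (^-distribʳ-* (- (+ 1)) (- (+ 1)) j)) (^-zeroˡ j))

  -1^odd : ∀ j → (- (+ 1)) ℤ.^ suc (j ℕ.+ j) ≡ - (+ 1)
  -1^odd j = cong (- (+ 1) *_) (-1^even j)

  module Cases (A B : ℤ) (h : ℕ) (pp : Prime (suc (h ℕ.+ h))) (nb : ¬ (B ≈[ suc (h ℕ.+ h) ] + 0)) where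
    open OddPrime A B h pp
    open Descent nb

    Goal : ℕ → Set
    Goal k = Conclusions p k A B ε (ε ℤ.^ suc k) (ε ℤ.^ k) (ε ℤ.^ 1)
               (∣ + (p ℕ.^ suc k) - ε ℤ.^ suc k ∣) (∣ + (p ℕ.^ k) - ε ℤ.^ k ∣) (∣ + p - ε ℤ.^ 1 ∣)

    one* : ∀ x → x ≡ + 1 * x
    one* = solve-∀
    one*one* : ∀ x → x ≡ + 1 * (+ 1 * x)
    one*one* = solve-∀
    B*one* : ∀ B x → B * x ≡ B * + 1 * x
    B*one* = solve-∀

    split-case : ε ≡ + 1 → ∀ k → Goal k
    split-case e k = transport {k = k} e (trans (cong (ℤ._^ suc k) e) (^-zeroˡ (suc k))) (trans (cong (ℤ._^ k) e) (^-zeroˡ k))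
        (cong (ℤ._^ 1) e)
        (trans (cong (λ t → ∣ + N - t ∣) (trans (cong (ℤ._^ suc k) e) (^-zeroˡ (suc k)))) (∣N-1∣ N (pow≥1 (suc k))))
        (trans (cong (λ t → ∣ + M - t ∣) (trans (cong (ℤ._^ k) e) (^-zeroˡ k))) (∣N-1∣ M (pow≥1 k)))
        (cong (λ t → ∣ + p - t ℤ.^ 1 ∣) e)
        (let u₂ , u₁ , v₂ , v₁ = split-descent e k in
          toDiv (ctrans (split-u e nb) (ceq (one*one* _)))
        , toDiv (ctrans u₂ (ceq (one*one* _)))
        , toDiv u₁
        , toDiv (ctrans (split-v e nb) (ceq (one* _)))
        , toDiv (ctrans v₂ (ceq (one* _)))
        , toDiv (ctrans v₁ (ceq (one* _))))
      where open Level k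

    inert-even-case : ε ≡ - (+ 1) → ∀ j → Goal (j ℕ.+ j)
    inert-even-case e j = transport {k = k} e (trans (cong (ℤ._^ suc k) e) (-1^odd j)) (trans (cong (ℤ._^ k) e) (-1^even j))
        (cong (ℤ._^ 1) e)
        (trans (cong (λ t → ∣ + N - t ∣) (trans (cong (ℤ._^ suc k) e) (-1^odd j))) (∣N+1∣ N))
        (trans (cong (λ t → ∣ + M - t ∣) (trans (cong (ℤ._^ k) e) (-1^even j))) (∣N-1∣ M (pow≥1 k)))
        (trans (cong (λ t → ∣ + p - t ℤ.^ 1 ∣) e) (∣N+1∣ p))
        (let u₂ , u₁ , v₂ , v₁ = inert-even e j in
          toDiv (ctrans u-after′ (ceq (B*one* B _)))
        , toDiv (ctrans u₂ (ceq (one*one* _)))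
        , toDiv u₁
        , toDiv (ctrans v-after′ (ceq (B*one* B _)))
        , toDiv (ctrans v₂ (ceq (one* _)))
        , toDiv (ctrans v₁ (ceq (B*one* B _))))
      where k = j ℕ.+ j
            open Level k
            open Inert e

    inert-odd-case : ε ≡ - (+ 1) → ∀ j → Goal (suc (j ℕ.+ j))
    inert-odd-case e j = transport {k = k} e (trans (cong (ℤ._^ suc k) e) (cong (- (+ 1) *_) (-1^odd j))) (trans (cong (ℤ._^ k) e) (-1^odd j))
        (cong (ℤ._^ 1) e)
        (trans (cong (λ t → ∣ + N - t ∣) (trans (cong (ℤ._^ suc k) e) (cong (- (+ 1) *_) (-1^odd j)))) (∣N-1∣ N (pow≥1 (suc k))))
        (trans (cong (λ t → ∣ + M - t ∣) (trans (cong (ℤ._^ k) e) (-1^odd j))) (∣N+1∣ M))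
        (trans (cong (λ t → ∣ + p - t ℤ.^ 1 ∣) e) (∣N+1∣ p))
        (let u₂ , u₁ , v₂ , v₁ = inert-odd e j in
          toDiv (ctrans (ceq (sym (B*one* B _))) u-before′)
        , toDiv (ctrans (ceq (sym (B*one* B _))) u₂)
        , toDiv u₁
        , toDiv (ctrans (ceq (sym (B*one* B _))) v-before′)
        , toDiv (ctrans (ceq (sym (B*one* B _))) v₂)
        , toDiv (ctrans v₁ (ceq (one* _))))
      where k = suc (j ℕ.+ j)
            open Level k
            open Inert e

  module _ {p : ℕ} (B D : ℤ) (nd : ¬ ((+ p) ∣ (+ 2 * B * D))) where
    p≢2 : p ≢ 2
    p≢2 refl = nd (toDiv0 (B * D , norm B D))
      where norm : ∀ B D → + 2 * B * D ≡ + 0 + B * D * + 2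
            norm = solve-∀

    p∤B : ¬ (B ≈[ p ] + 0)
    p∤B z = nd (toDiv0 (ctrans (c* (c*l (+ 2) z) crefl) (ceq (norm D))))
      where norm : ∀ D → + 2 * + 0 * D ≡ + 0
            norm = solve-∀

    p∤D : ¬ ((+ p) ∣ D)
    p∤D dv = nd (toDiv0 (ctrans (c*l (+ 2 * B) (fromDiv {D} dv)) (ceq (norm B))))
      where norm : ∀ B → + 2 * B * + 0 ≡ + 0
            norm = solve-∀

  coprime-part : ∀ p (pp : Prime p) k A B → ¬ ((+ p) ∣ (+ 2 * B * (A ℤ.^ 2 - + 4 * B))) →
    let L = legendre p (A ℤ.^ 2 - + 4 * B) in
    Conclusions p k A B L (L ℤ.^ suc k) (L ℤ.^ k) (L ℤ.^ 1)
      (∣ + (p ℕ.^ suc k) - L ℤ.^ suc k ∣) (∣ + (p ℕ.^ k) - L ℤ.^ k ∣) (∣ + p - L ℤ.^ 1 ∣)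
  coprime-part p pp k A B nd with two-or-odd p pp
  ... | inj₁ p≡2 = ⊥-elim (p≢2 B _ nd p≡2)
  ... | inj₂ (odd h) with legendre-unit p (A ℤ.^ 2 - + 4 * B) (p∤D B _ nd) | parity k
  ...   | inj₁ e | _ = Cases.split-case A B h pp (p∤B B _ nd) e k
  ...   | inj₂ e | even j = Cases.inert-even-case A B h pp (p∤B B _ nd) e j
  ...   | inj₂ e | odd j = Cases.inert-odd-case A B h pp (p∤B B _ nd) e j

  u-part : ∀ p (pp : Prime p) k A B → p ≢ 2 →
    lucasU A B (p ℕ.^ suc k) ≡ legendre p (A ℤ.^ 2 - + 4 * B) * lucasU A B (p ℕ.^ k) [mod p ℕ.^ suc k ]
  u-part p pp k A B p≢2 with two-or-odd p pp
  ... | inj₁ refl = ⊥-elim (p≢2 refl)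
  ... | inj₂ (odd h) = toDiv (OddPrime.Level.u-prime-power A B h pp k)

  v-part : ∀ p (pp : Prime p) k A B → lucasV A B (p ℕ.^ suc k) ≡ lucasV A B (p ℕ.^ k) [mod p ℕ.^ suc k ]
  v-part p pp k A B = toDiv (proj₁ (v-prime-power A B p pp k))


open import Defs
open import Data.Nat as ℕ using (ℕ; _∸_; _≤_; suc; s≤s; z≤n)
open import Data.Nat.Primality using (Prime)
open import Data.Integer as ℤ using (ℤ; +_; _-_; _*_; ∣_∣)
open import Data.Integer.Divisibility using (_∣_)
open import Data.Integer.DivMod using (_/_)
open import Data.Product using (_×_; _,_)
open import Relation.Nullary using (¬_)
open import Relation.Binary.PropositionalEquality using (_≢_)
open Assembly using (v-part; u-part; coprime-part)

lemma2p3 : (p : ℕ) → Prime p → (a : ℕ) → 1 ≤ a → (A B : ℤ) →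
  let Δ = A ℤ.^ 2 - + 4 * B
      u = lucasU A B
      v = lucasV A B
      q = p ℕ.^ a
      q₁ = p ℕ.^ (a ∸ 1)
      εa = jacobiPP p a Δ
      εa₁ = jacobiPP p (a ∸ 1) Δ
      ε₁ = jacobiPP p 1 Δ
      n = ∣ + q - εa ∣
      n₁ = ∣ + q₁ - εa₁ ∣
      m = ∣ + p - ε₁ ∣
  in (v q ≡ v q₁ [mod q ])
     × ((p ≢ 2) → u q ≡ legendre p Δ * u q₁ [mod q ])
     × (¬ ((+ p) ∣ (+ 2 * B * Δ)) →
          congBPow q B ((εa₁ - εa) / (+ 2)) (u n) (legendre p Δ * u n₁)
        × congBPow (p ℕ.^ 2) B ((ε₁ - εa) / (+ 2)) (u n) (εa₁ * u m)
        × (u n ≡ + 0 [mod p ])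
        × congBPow q B ((εa₁ - εa) / (+ 2)) (v n) (v n₁)
        × congBPow (p ℕ.^ 2) B ((ε₁ - εa) / (+ 2)) (v n) (v m)
        × congBPow p B ((+ 1 - εa) / (+ 2)) (v n) (+ 2))
lemma2p3 p pp (suc k) (s≤s z≤n) A B = v-part p pp k A B , u-part p pp k A B , coprime-part p pp k A B
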